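{- Let $m>3$ and let $SD_m$ be the group generated by $x,y$ with relations $x^{2^{m-1}}=y^2=e$ and $yx=x^ky$, where $k=-1+2^{m-2}$. The saturated subsets of $SD_m$ are: $\{e,x^{2^{m-2}}\}$; the sets $\{x^{2j},x^{s}\}$ where $2j,s\not\equiv 0,2^{m-2}$ (modulo $2^{m-1}$) and $2j$ and $s$ have the same divisibility by $2$; and $A\cup B$, $A\cup C$, $B\cup C$, where $A=\{x,x^3,\ldots,x^{2^{m-1}-1}\}$, $B=\{y,yx^2,\ldots,yx^{2^{m-1}-2}\}$, $C=\{yx,yx^3,\ldots,yx^{2^{m-1}-1}\}$.
   Context: For a group $S$, a subset $U\subseteq S$ is avoidable if there is a partition $\{A',B'\}$ of $S$ such that no element of $U$ equals $uv$ with $u\neq v$ both in $A'$ or both in $B'$ (in either order). A subset is saturated if it is maximal with respect to inclusion among the avoidable subsets. Elements of $SD_m$ are written uniquely as $x^a$ or $yx^a$ with $a\in\mathbb{Z}/2^{m-1}\mathbb{Z}$. -}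

module Defs where

open import Data.Nat using (ℕ; zero; suc; _+_; _*_; _∸_; _^_; NonZero; _≡ᵇ_)
open import Data.Nat.Properties using (m^n≢0)
open import Data.Nat.DivMod using (_mod_; _%_)
open import Data.Nat.Divisibility using (_∣_)
open import Data.Fin using (Fin; toℕ)
open import Data.Bool using (Bool; true; false; _∨_)
open import Data.Product using (Σ; ∃; _×_; _,_)
open import Relation.Binary.PropositionalEquality using (_≡_; _≢_)
open import Function.Bundles using (_⇔_)

ord : ℕ → ℕ
ord m = 2 ^ (m ∸ 1)

ord-nz : ∀ m → NonZero (ord m)
ord-nz m = m^n≢0 2 (m ∸ 1)

red : (m : ℕ) → ℕ → Fin (ord m)
red m a = _mod_ a (ord m) {{ord-nz m}}

-- k = -1 + 2^(m-2), represented by the natural number (2^(m-1) - 1) + 2^(m-2)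
kexp : ℕ → ℕ
kexp m = (ord m ∸ 1) + 2 ^ (m ∸ 2)

-- Elements of SD_m in normal form: x^a and y x^a with a ∈ ℤ/2^(m-1)ℤ.
data SD (m : ℕ) : Set where
  xp  : Fin (ord m) → SD m
  yxp : Fin (ord m) → SD m

-- Group multiplication, derived from the relations x^(2^(m-1)) = y^2 = e and
-- y x = x^k y (so y x^a = x^(k a) y and, as k^2 ≡ 1, x^a y = y x^(k a)).
mul : {m : ℕ} → SD m → SD m → SD m
mul {m} (xp a)  (xp b)  = xp  (red m (toℕ a + toℕ b))
mul {m} (xp a)  (yxp b) = yxp (red m (kexp m * toℕ a + toℕ b))
mul {m} (yxp a) (xp b)  = yxp (red m (toℕ a + toℕ b))
mul {m} (yxp a) (yxp b) = xp  (red m (kexp m * toℕ a + toℕ b))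

Subset : ℕ → Set
Subset m = SD m → Bool

_⊆_ : {m : ℕ} → Subset m → Subset m → Set
U ⊆ V = ∀ g → U g ≡ true → V g ≡ true

_≐_ : {m : ℕ} → Subset m → Subset m → Set
U ≐ V = ∀ g → U g ≡ V g

IsPartition : {m : ℕ} → (SD m → Bool) → Set
IsPartition {m} c = (∃ λ (a : SD m) → c a ≡ true) × (∃ λ (b : SD m) → c b ≡ false)

Avoidable : {m : ℕ} → Subset m → Set
Avoidable {m} U =
  Σ (SD m → Bool) λ c → IsPartition c ×
    (∀ (u v : SD m) → u ≢ v → c u ≡ c v → U (mul u v) ≡ false)

Saturated : {m : ℕ} → Subset m → Set
Saturated {m} U = Avoidable U × (∀ (V : Subset m) → Avoidable V → U ⊆ V → V ⊆ U)

isOdd : ℕ → Bool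
isOdd a = (a % 2) ≡ᵇ 1

isEven : ℕ → Bool
isEven a = (a % 2) ≡ᵇ 0

-- 2^(m-2), the exponent of the central involution
half : ℕ → ℕ
half m = 2 ^ (m ∸ 2)

SameVal2 : ℕ → ℕ → Set
SameVal2 a b = ∀ t → (2 ^ t ∣ a) ⇔ (2 ^ t ∣ b)

E0 : (m : ℕ) → Subset m
E0 m (xp a)  = (toℕ a ≡ᵇ 0) ∨ (toℕ a ≡ᵇ half m)
E0 m (yxp a) = false

Pair : (m : ℕ) → Fin (ord m) → Fin (ord m) → Subset m
Pair m e s (xp a)  = (toℕ a ≡ᵇ toℕ e) ∨ (toℕ a ≡ᵇ toℕ s)
Pair m e s (yxp a) = false

SetA : (m : ℕ) → Subset m
SetA m (xp a)  = isOdd (toℕ a)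
SetA m (yxp a) = false

SetB : (m : ℕ) → Subset m
SetB m (xp a)  = false
SetB m (yxp a) = isEven (toℕ a)

SetC : (m : ℕ) → Subset m
SetC m (xp a)  = false
SetC m (yxp a) = isOdd (toℕ a)

_∪_ : {m : ℕ} → Subset m → Subset m → Subset m
(U ∪ V) g = U g ∨ V g

{-# OPTIONS --safe #-}
module Submission where

-- Exponents are integers modulo N = 2^(m-1).  With K ≡ k, the multiplication reads
-- x^a x^b = x^(a+b), x^a · yx^b = yx^(Ka+b), yx^a · x^b = yx^(a+b), yx^a · yx^b = x^(Ka+b),
-- where Ka ≡ -a for even a and Ka ≡ 2^(m-2) - a for odd a.  So a colouring of SD_m is a pair
-- of colourings P, Q of the exponents of x^a and of yx^a, and every element of a set V forces
-- certain pairs of exponents to receive different colours.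
--
-- The listed sets are avoidable: A ∪ B, A ∪ C and B ∪ C by colouring according to parities
-- and cosets of ⟨x⟩; a pair {x^c₁, x^c₂} by a colouring of the x^a in which a₁ + a₂ ∈ {c₁, c₂}
-- forces different colours, and a colouring of the yx^a by the binary digit of a in the
-- position of the 2-adic valuation of c₁ and c₂.
--
-- Conversely, the forced inequalities coming from an avoidable V give odd cycles, or a
-- colouring invariant under a translation that must also change it, unless V lies in a listed
-- set.  The arithmetic behind this: a periodic colouring of ℤ/2^R flipped by translations by d₁
-- and by d₂ forces d₁ and d₂ to have the same 2-adic valuation.  As no listed set contains
-- another, the saturated sets are exactly the listed ones.

open import Defs
open import Data.Nat as ℕ using (ℕ; zero; suc; _<_; ⌊_/2⌋; s≤s; z≤n)
import Data.Nat.Properties as ℕP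
open import Data.Nat.DivMod as ℕDivMod using (_%_; _/_)
open import Data.Nat.Divisibility as ℕ∣ using (_∣_; divides)
open import Data.Integer as ℤ using (ℤ; +_; -[1+_]; _+_; _*_; _-_; -_)
import Data.Integer.Properties as ℤP
import Data.Integer.DivMod as ℤDivMod
open import Data.Integer.Tactic.RingSolver using (solve-∀; solve)
open import Data.List using (_∷_; [])
open import Data.Fin as Fin using (Fin; toℕ)
import Data.Fin.Properties as FinP
open import Data.Bool using (Bool; true; false; not; _xor_; _∨_; if_then_else_)
import Data.Bool.Properties as BoolP
open import Data.Product using (Σ; ∃; _×_; _,_; proj₁; proj₂)
open import Data.Sum using (_⊎_; inj₁; inj₂; [_,_]′)
import Data.Sum as Sum
open import Data.Empty using (⊥; ⊥-elim)
open import Relation.Binary.PropositionalEquality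
open import Relation.Binary.Bundles using (Setoid)
import Relation.Binary.Reasoning.Setoid as SetoidReasoning
open import Relation.Nullary using (¬_; Dec; yes; no)
open import Relation.Nullary.Decidable using (_×-dec_; ¬?; decidable-stable)
open import Function using (_∘_; id)
open import Function.Bundles using (_⇔_; mk⇔; Equivalence)
open import Level using (0ℓ)

≢-≢⇒≡ : ∀ {x y z : Bool} → x ≢ y → y ≢ z → x ≡ z
≢-≢⇒≡ x≢y y≢z = trans (BoolP.¬-not x≢y) (sym (BoolP.¬-not (≢-sym y≢z)))

≢-resp : ∀ {A : Set} {x x' y y' : A} → x ≡ x' → y ≡ y' → x' ≢ y' → x ≢ y
≢-resp refl refl x'≢y' = x'≢y'

true≢false : true ≢ false
true≢false ()

no-three-distinct : ∀ {x y z : Bool} → x ≢ y → x ≢ z → y ≢ z → ⊥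
no-three-distinct x≢y x≢z y≢z = y≢z (≢-≢⇒≡ (≢-sym x≢y) x≢z)

xor-true⇒≢ : ∀ {x y} → (x xor y) ≡ true → x ≢ y
xor-true⇒≢ {x} e refl = true≢false (trans (sym e) (BoolP.xor-same x))

xor-false⇒≡ : ∀ {x y} → (x xor y) ≡ false → x ≡ y
xor-false⇒≡ {true}  {true}  _ = refl
xor-false⇒≡ {false} {false} _ = refl

not-true⇒false : ∀ {x} → not x ≡ true → x ≡ false
not-true⇒false {false} _ = refl

∨-true⇒ : ∀ {p q} → (p ∨ q) ≡ true → p ≡ true ⊎ q ≡ true
∨-true⇒ {true}  _ = inj₁ refl
∨-true⇒ {false} e = inj₂ e

∨-trueˡ : ∀ {p q} → p ≡ true → (p ∨ q) ≡ true
∨-trueˡ refl = refl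

∨-trueʳ : ∀ {p q} → q ≡ true → (p ∨ q) ≡ true
∨-trueʳ {p} refl = BoolP.∨-zeroʳ p

oddᵇ : ℕ → Bool
oddᵇ zero          = false
oddᵇ (suc zero)    = true
oddᵇ (suc (suc n)) = oddᵇ n

even⇒≡2*⌊/2⌋ : ∀ n → oddᵇ n ≡ false → n ≡ 2 ℕ.* ⌊ n /2⌋
even⇒≡2*⌊/2⌋ zero          _ = refl
even⇒≡2*⌊/2⌋ (suc (suc n)) e =
  trans (cong (2 ℕ.+_) (even⇒≡2*⌊/2⌋ n e)) (sym (ℕP.*-suc 2 ⌊ n /2⌋))

odd⇒≡2*⌊/2⌋+1 : ∀ n → oddᵇ n ≡ true → n ≡ 2 ℕ.* ⌊ n /2⌋ ℕ.+ 1
odd⇒≡2*⌊/2⌋+1 (suc zero)    _ = refl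
odd⇒≡2*⌊/2⌋+1 (suc (suc n)) o =
  trans (cong (2 ℕ.+_) (odd⇒≡2*⌊/2⌋+1 n o)) (cong (ℕ._+ 1) (sym (ℕP.*-suc 2 ⌊ n /2⌋)))

oddᵇ-*2 : ∀ q → oddᵇ (q ℕ.* 2) ≡ false
oddᵇ-*2 zero    = refl
oddᵇ-*2 (suc q) = oddᵇ-*2 q

2∣⇒even : ∀ {x} → 2 ∣ x → oddᵇ x ≡ false
2∣⇒even (divides q refl) = oddᵇ-*2 q

even⇒2∣ : ∀ x → oddᵇ x ≡ false → 2 ∣ x
even⇒2∣ x e = divides ⌊ x /2⌋ (trans (even⇒≡2*⌊/2⌋ x e) (ℕP.*-comm 2 ⌊ x /2⌋))

≡ᵇ-true⇒≡ : ∀ x y → (x ℕ.≡ᵇ y) ≡ true → x ≡ y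
≡ᵇ-true⇒≡ x y e = ℕP.≡ᵇ⇒≡ x y (Equivalence.from BoolP.T-≡ e)

≡⇒≡ᵇ-true : ∀ {x y} → x ≡ y → (x ℕ.≡ᵇ y) ≡ true
≡⇒≡ᵇ-true {x} {y} e = Equivalence.to BoolP.T-≡ (ℕP.≡⇒≡ᵇ x y e)

≢⇒≡ᵇ-false : ∀ {x y} → x ≢ y → (x ℕ.≡ᵇ y) ≡ false
≢⇒≡ᵇ-false {x} {y} x≢y with x ℕ.≡ᵇ y in e
... | false = refl
... | true  = ⊥-elim (x≢y (≡ᵇ-true⇒≡ x y e))

isOdd≡oddᵇ : ∀ x → isOdd x ≡ oddᵇ x
isOdd≡oddᵇ zero          = refl
isOdd≡oddᵇ (suc zero)    = refl
isOdd≡oddᵇ (suc (suc x)) =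
  trans (cong (λ r → r ℕ.≡ᵇ 1) (trans (cong (_% 2) (ℕP.+-comm 2 x)) (ℕDivMod.[m+n]%n≡m%n x 2)))
        (isOdd≡oddᵇ x)

isEven≡not-oddᵇ : ∀ x → isEven x ≡ not (oddᵇ x)
isEven≡not-oddᵇ zero          = refl
isEven≡not-oddᵇ (suc zero)    = refl
isEven≡not-oddᵇ (suc (suc x)) =
  trans (cong (λ r → r ℕ.≡ᵇ 0) (trans (cong (_% 2) (ℕP.+-comm 2 x)) (ℕDivMod.[m+n]%n≡m%n x 2)))
        (isEven≡not-oddᵇ x)

+-‿-cancelʳ : ∀ a x → a + x - x ≡ a
+-‿-cancelʳ = solve-∀

-‿+-cancelʳ : ∀ a x → a - x + x ≡ a
-‿+-cancelʳ = solve-∀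

a+[t-a]≡t : ∀ a t → a + (t - a) ≡ t
a+[t-a]≡t = solve-∀

+-cancelʳ : ∀ x {a b} → a + x ≡ b + x → a ≡ b
+-cancelʳ x {a} {b} e = trans (sym (+-‿-cancelʳ a x)) (trans (cong (_- x) e) (+-‿-cancelʳ b x))

odd : ℤ → Bool
odd (+ n)    = oddᵇ n
odd -[1+ n ] = not (oddᵇ n)

⌊_/2⌋ᶻ : ℤ → ℤ
⌊ + n    /2⌋ᶻ = + ⌊ n /2⌋
⌊ -[1+ n ] /2⌋ᶻ = -[1+ ⌊ n /2⌋ ]

ParitySplit : ℤ → Set
ParitySplit a = (odd a ≡ false × a ≡ + 2 * ⌊ a /2⌋ᶻ) ⊎ (odd a ≡ true × a ≡ + 2 * ⌊ a /2⌋ᶻ + + 1)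

parity-split : ∀ a → ParitySplit a
parity-split (+ n) with oddᵇ n in o
... | false = inj₁ (refl , trans (cong +_ (even⇒≡2*⌊/2⌋ n o)) (ℤP.pos-* 2 ⌊ n /2⌋))
... | true  = inj₂ (refl , (begin
  + n                            ≡⟨ cong +_ (odd⇒≡2*⌊/2⌋+1 n o) ⟩
  + (2 ℕ.* ⌊ n /2⌋ ℕ.+ 1)        ≡⟨ ℤP.pos-+ (2 ℕ.* ⌊ n /2⌋) 1 ⟩
  + (2 ℕ.* ⌊ n /2⌋) + + 1        ≡⟨ cong (_+ + 1) (ℤP.pos-* 2 ⌊ n /2⌋) ⟩
  + 2 * + ⌊ n /2⌋ + + 1          ∎))
  where open ≡-Reasoning
parity-split -[1+ n ] with oddᵇ n in o
... | true  = inj₁ (refl , (begin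
  - (+ 1 + + n)                  ≡⟨ cong (λ k → - (+ 1 + + k)) (odd⇒≡2*⌊/2⌋+1 n o) ⟩
  - (+ 1 + + (2 ℕ.* k ℕ.+ 1))    ≡⟨ cong (λ z → - (+ 1 + z))
                                         (trans (ℤP.pos-+ (2 ℕ.* k) 1) (cong (_+ + 1) (ℤP.pos-* 2 k))) ⟩
  - (+ 1 + (+ 2 * + k + + 1))    ≡⟨ lemma (+ k) ⟩
  + 2 * -[1+ k ]                 ∎))
  where
  open ≡-Reasoning
  k = ⌊ n /2⌋
  lemma : ∀ x → - (+ 1 + (+ 2 * x + + 1)) ≡ + 2 * (- (+ 1 + x))
  lemma = solve-∀
... | false = inj₂ (refl , (begin
  - (+ 1 + + n)                  ≡⟨ cong (λ k → - (+ 1 + + k)) (even⇒≡2*⌊/2⌋ n o) ⟩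
  - (+ 1 + + (2 ℕ.* k))          ≡⟨ cong (λ z → - (+ 1 + z)) (ℤP.pos-* 2 k) ⟩
  - (+ 1 + + 2 * + k)            ≡⟨ lemma (+ k) ⟩
  + 2 * -[1+ k ] + + 1           ∎))
  where
  open ≡-Reasoning
  k = ⌊ n /2⌋
  lemma : ∀ x → - (+ 1 + + 2 * x) ≡ + 2 * (- (+ 1 + x)) + + 1
  lemma = solve-∀

2*≢1 : ∀ z → + 2 * z ≢ + 1
2*≢1 (+ k)    eq = ℕP.even≢odd k 0 (ℤP.+-injective (trans (ℤP.pos-* 2 k) eq))
2*≢1 -[1+ k ] ()

2*≢2*+1 : ∀ x y → + 2 * x ≢ + 2 * y + + 1
2*≢2*+1 x y eq = 2*≢1 (x - y) (begin
  + 2 * (x - y)           ≡⟨ lemma₁ x y ⟩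
  + 2 * x - + 2 * y       ≡⟨ cong (_- + 2 * y) eq ⟩
  + 2 * y + + 1 - + 2 * y ≡⟨ lemma₂ y ⟩
  + 1                     ∎)
  where
  open ≡-Reasoning
  lemma₁ : ∀ x y → + 2 * (x - y) ≡ + 2 * x - + 2 * y
  lemma₁ = solve-∀
  lemma₂ : ∀ y → + 2 * y + + 1 - + 2 * y ≡ + 1
  lemma₂ = solve-∀

≡2*+1⇒odd : ∀ {a} w → a ≡ + 2 * w + + 1 → odd a ≡ true
≡2*+1⇒odd {a} w eq with parity-split a
... | inj₂ (o , _) = o
... | inj₁ (_ , e) = ⊥-elim (2*≢2*+1 ⌊ a /2⌋ᶻ w (trans (sym e) eq))

≡2*⇒even : ∀ {a} w → a ≡ + 2 * w → odd a ≡ false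
≡2*⇒even {a} w eq with parity-split a
... | inj₁ (o , _) = o
... | inj₂ (_ , e) = ⊥-elim (2*≢2*+1 w ⌊ a /2⌋ᶻ (trans (sym eq) e))

odd-+ : ∀ a b → odd (a + b) ≡ odd a xor odd b
odd-+ a b with parity-split a | parity-split b
... | inj₁ (oa , ea) | inj₁ (ob , eb) rewrite oa | ob =
  ≡2*⇒even (⌊ a /2⌋ᶻ + ⌊ b /2⌋ᶻ) (trans (cong₂ _+_ ea eb) (lemma ⌊ a /2⌋ᶻ ⌊ b /2⌋ᶻ))
  where lemma : ∀ x y → + 2 * x + + 2 * y ≡ + 2 * (x + y)
        lemma = solve-∀
... | inj₁ (oa , ea) | inj₂ (ob , eb) rewrite oa | ob =
  ≡2*+1⇒odd (⌊ a /2⌋ᶻ + ⌊ b /2⌋ᶻ) (trans (cong₂ _+_ ea eb) (lemma ⌊ a /2⌋ᶻ ⌊ b /2⌋ᶻ))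
  where lemma : ∀ x y → + 2 * x + (+ 2 * y + + 1) ≡ + 2 * (x + y) + + 1
        lemma = solve-∀
... | inj₂ (oa , ea) | inj₁ (ob , eb) rewrite oa | ob =
  ≡2*+1⇒odd (⌊ a /2⌋ᶻ + ⌊ b /2⌋ᶻ) (trans (cong₂ _+_ ea eb) (lemma ⌊ a /2⌋ᶻ ⌊ b /2⌋ᶻ))
  where lemma : ∀ x y → + 2 * x + + 1 + + 2 * y ≡ + 2 * (x + y) + + 1
        lemma = solve-∀
... | inj₂ (oa , ea) | inj₂ (ob , eb) rewrite oa | ob =
  ≡2*⇒even (⌊ a /2⌋ᶻ + ⌊ b /2⌋ᶻ + + 1) (trans (cong₂ _+_ ea eb) (lemma ⌊ a /2⌋ᶻ ⌊ b /2⌋ᶻ))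
  where lemma : ∀ x y → + 2 * x + + 1 + (+ 2 * y + + 1) ≡ + 2 * (x + y + + 1)
        lemma = solve-∀

odd-2* : ∀ x → odd (+ 2 * x) ≡ false
odd-2* x = ≡2*⇒even x refl

odd-2*+1 : ∀ x → odd (+ 2 * x + + 1) ≡ true
odd-2*+1 x = ≡2*+1⇒odd x refl

odd-+2* : ∀ a b → odd (a + + 2 * b) ≡ odd a
odd-+2* a b = trans (odd-+ a (+ 2 * b)) (trans (cong (odd a xor_) (odd-2* b)) (BoolP.xor-identityʳ (odd a)))

odd-neg : ∀ a → odd (- a) ≡ odd a
odd-neg a with parity-split a
... | inj₁ (o , e) rewrite o = ≡2*⇒even (- ⌊ a /2⌋ᶻ) (trans (cong -_ e) (lemma ⌊ a /2⌋ᶻ))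
  where lemma : ∀ x → - (+ 2 * x) ≡ + 2 * (- x)
        lemma = solve-∀
... | inj₂ (o , e) rewrite o = ≡2*+1⇒odd (- ⌊ a /2⌋ᶻ - + 1) (trans (cong -_ e) (lemma ⌊ a /2⌋ᶻ))
  where lemma : ∀ x → - (+ 2 * x + + 1) ≡ + 2 * (- x - + 1) + + 1
        lemma = solve-∀

odd-- : ∀ a b → odd (a - b) ≡ odd a xor odd b
odd-- a b = trans (odd-+ a (- b)) (cong (odd a xor_) (odd-neg b))

⌊2*/2⌋ᶻ : ∀ x → ⌊ + 2 * x /2⌋ᶻ ≡ x
⌊2*/2⌋ᶻ x with parity-split (+ 2 * x)
... | inj₁ (_ , e) = sym (ℤP.*-cancelˡ-≡ (+ 2) x _ e)
... | inj₂ (_ , e) = ⊥-elim (2*≢2*+1 x ⌊ + 2 * x /2⌋ᶻ e)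

⌊2*+1/2⌋ᶻ : ∀ x → ⌊ + 2 * x + + 1 /2⌋ᶻ ≡ x
⌊2*+1/2⌋ᶻ x with parity-split (+ 2 * x + + 1)
... | inj₂ (_ , e) = sym (ℤP.*-cancelˡ-≡ (+ 2) x _ (+-cancelʳ (+ 1) e))
... | inj₁ (_ , e) = ⊥-elim (2*≢2*+1 ⌊ + 2 * x + + 1 /2⌋ᶻ x (sym e))

⌊+2*/2⌋ᶻ : ∀ a h → ⌊ a + + 2 * h /2⌋ᶻ ≡ ⌊ a /2⌋ᶻ + h
⌊+2*/2⌋ᶻ a h with parity-split a
... | inj₁ (_ , e) = begin
  ⌊ a + + 2 * h /2⌋ᶻ                ≡⟨ cong (λ x → ⌊ x + + 2 * h /2⌋ᶻ) e ⟩
  ⌊ + 2 * ⌊ a /2⌋ᶻ + + 2 * h /2⌋ᶻ   ≡⟨ cong ⌊_/2⌋ᶻ (sym (ℤP.*-distribˡ-+ (+ 2) ⌊ a /2⌋ᶻ h)) ⟩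
  ⌊ + 2 * (⌊ a /2⌋ᶻ + h) /2⌋ᶻ       ≡⟨ ⌊2*/2⌋ᶻ (⌊ a /2⌋ᶻ + h) ⟩
  ⌊ a /2⌋ᶻ + h                      ∎
  where open ≡-Reasoning
... | inj₂ (_ , e) = begin
  ⌊ a + + 2 * h /2⌋ᶻ                       ≡⟨ cong (λ x → ⌊ x + + 2 * h /2⌋ᶻ) e ⟩
  ⌊ + 2 * ⌊ a /2⌋ᶻ + + 1 + + 2 * h /2⌋ᶻ    ≡⟨ cong ⌊_/2⌋ᶻ (lemma ⌊ a /2⌋ᶻ h) ⟩
  ⌊ + 2 * (⌊ a /2⌋ᶻ + h) + + 1 /2⌋ᶻ        ≡⟨ ⌊2*+1/2⌋ᶻ (⌊ a /2⌋ᶻ + h) ⟩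
  ⌊ a /2⌋ᶻ + h                             ∎
  where
  open ≡-Reasoning
  lemma : ∀ x h → + 2 * x + + 1 + + 2 * h ≡ + 2 * (x + h) + + 1
  lemma = solve-∀

infix 4 _≡_mod_

record _≡_mod_ (a b M : ℤ) : Set where
  constructor _,_
  field
    quotient : ℤ
    equation : a ≡ b + quotient * M

module _ {M : ℤ} where

  mod-refl : ∀ {a} → a ≡ a mod M
  mod-refl {a} = + 0 , solve (a ∷ M ∷ [])

  ≡⇒mod : ∀ {a b} → a ≡ b → a ≡ b mod M
  ≡⇒mod refl = mod-refl

  mod-sym : ∀ {a b} → a ≡ b mod M → b ≡ a mod M
  mod-sym {a} {b} (q , refl) = - q , solve (b ∷ q ∷ M ∷ [])

  mod-trans : ∀ {a b c} → a ≡ b mod M → b ≡ c mod M → a ≡ c mod M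
  mod-trans {c = c} (q₁ , refl) (q₂ , refl) = q₁ + q₂ , solve (c ∷ q₁ ∷ q₂ ∷ M ∷ [])

  mod-+ : ∀ {a b c d} → a ≡ b mod M → c ≡ d mod M → a + c ≡ b + d mod M
  mod-+ {b = b} {d = d} (q₁ , refl) (q₂ , refl) = q₁ + q₂ , solve (b ∷ d ∷ q₁ ∷ q₂ ∷ M ∷ [])

  mod-*ˡ : ∀ x {a b} → a ≡ b mod M → x * a ≡ x * b mod M
  mod-*ˡ x {b = b} (q , refl) = x * q , solve (x ∷ b ∷ q ∷ M ∷ [])

  mod-+ˡ : ∀ x {a b} → a ≡ b mod M → x + a ≡ x + b mod M
  mod-+ˡ x = mod-+ (mod-refl {x})

  mod-+ʳ : ∀ x {a b} → a ≡ b mod M → a + x ≡ b + x mod M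
  mod-+ʳ x a≡b = mod-+ a≡b (mod-refl {x})

  mod-cong : ∀ {a b a' b'} → a ≡ a' → b ≡ b' → a ≡ b mod M → a' ≡ b' mod M
  mod-cong refl refl a≡b = a≡b

  mod-* : ∀ {a b c d} → a ≡ b mod M → c ≡ d mod M → a * c ≡ b * d mod M
  mod-* {a} {b} {c} {d} a≡b c≡d =
    mod-trans (mod-*ˡ a c≡d) (mod-cong (ℤP.*-comm d a) (ℤP.*-comm d b) (mod-*ˡ d a≡b))

  mod-+ʳ-cancel : ∀ x {a b} → a + x ≡ b + x mod M → a ≡ b mod M
  mod-+ʳ-cancel x {a} {b} a+x≡b+x =
    mod-cong (+-‿-cancelʳ a x) (+-‿-cancelʳ b x) (mod-+ʳ (- x) a+x≡b+x)

  mod-+ˡ-cancel : ∀ x {a b} → x + a ≡ x + b mod M → a ≡ b mod M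
  mod-+ˡ-cancel x {a} {b} e = mod-+ʳ-cancel x (mod-cong (ℤP.+-comm x a) (ℤP.+-comm x b) e)

  mod-+⇒- : ∀ {a b c} → a + b ≡ c mod M → a ≡ c - b mod M
  mod-+⇒- {a} {b} a+b≡c = mod-cong (+-‿-cancelʳ a b) refl (mod-+ʳ (- b) a+b≡c)

  mod-difference : ∀ {a b c d} → a ≡ b mod M → a - b ≡ c - d → c ≡ d mod M
  mod-difference {a} {b} {c} {d} a≡b a-b≡c-d = mod-cong (-‿+-cancelʳ c d) (ℤP.+-identityˡ d)
    (mod-+ʳ d (mod-cong a-b≡c-d (ℤP.+-inverseʳ b) (mod-+ʳ (- b) a≡b)))

  mod-reflect : ∀ o {a b} → a ≡ b mod M → o - a ≡ o - b mod M
  mod-reflect o {a} {b} a≡b =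
    mod-+ˡ o (mod-cong (ℤP.-1*i≡-i a) (ℤP.-1*i≡-i b) (mod-*ˡ (- + 1) a≡b))

mod-setoid : ℤ → Setoid 0ℓ 0ℓ
mod-setoid M = record
  { Carrier       = ℤ
  ; _≈_           = λ a b → a ≡ b mod M
  ; isEquivalence = record { refl = mod-refl ; sym = mod-sym ; trans = mod-trans }
  }

module mod-Reasoning (M : ℤ) = SetoidReasoning (mod-setoid M)

mod-modulus : ∀ {M M' a b} → M ≡ M' → a ≡ b mod M → a ≡ b mod M'
mod-modulus refl a≡b = a≡b

mod-2* : ∀ {M a b} → a ≡ b mod M → + 2 * a ≡ + 2 * b mod (+ 2 * M)
mod-2* {M} {b = b} (q , refl) = q , solve (b ∷ q ∷ M ∷ [])

mod-2*+1 : ∀ {M a b} → a ≡ b mod M → + 2 * a + + 1 ≡ + 2 * b + + 1 mod (+ 2 * M)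
mod-2*+1 a≡b = mod-+ʳ (+ 1) (mod-2* a≡b)

mod-2*-cancel : ∀ {M a b} → + 2 * a ≡ + 2 * b mod (+ 2 * M) → a ≡ b mod M
mod-2*-cancel {M} {a} {b} (q , e) =
  q , ℤP.*-cancelˡ-≡ (+ 2) a (b + q * M) (trans e (solve (b ∷ q ∷ M ∷ [])))

mod-2*+1-cancel : ∀ {M a b} → + 2 * a + + 1 ≡ + 2 * b + + 1 mod (+ 2 * M) → a ≡ b mod M
mod-2*+1-cancel e = mod-2*-cancel (mod-+ʳ-cancel (+ 1) e)

mod-2*⇒mod : ∀ {M a b} → a ≡ b mod (+ 2 * M) → a ≡ b mod M
mod-2*⇒mod {M} {b = b} (q , refl) = q * + 2 , solve (b ∷ q ∷ M ∷ [])

mod-2*⇒odd≡ : ∀ {M a b} → a ≡ b mod (+ 2 * M) → odd a ≡ odd b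
mod-2*⇒odd≡ {M} {b = b} (q , refl) = begin
  odd (b + q * (+ 2 * M))        ≡⟨ odd-+ b (q * (+ 2 * M)) ⟩
  odd b xor odd (q * (+ 2 * M))  ≡⟨ cong (odd b xor_) (≡2*⇒even {q * (+ 2 * M)} (q * M) (solve (q ∷ M ∷ []))) ⟩
  odd b xor false                ≡⟨ BoolP.xor-identityʳ (odd b) ⟩
  odd b                          ∎
  where open ≡-Reasoning

mod-2*⇒⌊/2⌋ : ∀ {M a b} → a ≡ b mod (+ 2 * M) → ⌊ a /2⌋ᶻ ≡ ⌊ b /2⌋ᶻ mod M
mod-2*⇒⌊/2⌋ {M} {a} {b} a≡b with parity-split a | parity-split b
... | inj₁ (_ , ea) | inj₁ (_ , eb) = mod-2*-cancel (mod-cong ea eb a≡b)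
... | inj₂ (_ , ea) | inj₂ (_ , eb) = mod-2*+1-cancel (mod-cong ea eb a≡b)
... | inj₁ (oa , _) | inj₂ (ob , _) = ⊥-elim (true≢false (trans (sym ob) (trans (sym (mod-2*⇒odd≡ a≡b)) oa)))
... | inj₂ (oa , _) | inj₁ (ob , _) = ⊥-elim (true≢false (trans (sym oa) (trans (mod-2*⇒odd≡ a≡b) ob)))

+-comm-mod : ∀ {M} a₁ a₂ {c} → a₁ + a₂ ≡ c mod M → a₂ + a₁ ≡ c mod M
+-comm-mod a₁ a₂ = mod-cong (ℤP.+-comm a₁ a₂) refl

mod-1 : ∀ a b → a ≡ b mod (+ 1)
mod-1 a b = a - b , solve (a ∷ b ∷ [])

-- Periodic colourings of ℤ and the translations that flip them

Periodic : ℤ → (ℤ → Bool) → Set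
Periodic M f = ∀ {a b} → a ≡ b mod M → f a ≡ f b

Invariant : (ℤ → Bool) → ℤ → Set
Invariant f d = ∀ z → f (z + d) ≡ f z

Flips : (ℤ → Bool) → ℤ → Set
Flips f d = ∀ z → f (z + d) ≢ f z

flips-resp : ∀ {M f d d'} → Periodic M f → d ≡ d' mod M → Flips f d → Flips f d'
flips-resp per d≡d' fl z = ≢-resp (per (mod-+ˡ z (mod-sym d≡d'))) refl (fl z)

invariant-multiples : ∀ {f d} → Invariant f d → ∀ i z → f (z + + i * d) ≡ f z
invariant-multiples {f} {d} inv zero    z = cong f (solve (z ∷ d ∷ []))
invariant-multiples {f} {d} inv (suc i) z = begin
  f (z + + suc i * d)      ≡⟨ cong f (lemma z (+ i) d) ⟩
  f ((z + + i * d) + d)    ≡⟨ inv (z + + i * d) ⟩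
  f (z + + i * d)          ≡⟨ invariant-multiples inv i z ⟩
  f z                      ∎
  where
  open ≡-Reasoning
  lemma : ∀ z i d → z + (+ 1 + i) * d ≡ (z + i * d) + d
  lemma = solve-∀

flips⇒invariant-twice : ∀ {f d} → Flips f d → Invariant f (d + d)
flips⇒invariant-twice {f} {d} fl z =
  trans (cong f (sym (ℤP.+-assoc z d d))) (≢-≢⇒≡ (fl (z + d)) (fl z))

2^ᶻ : ℕ → ℤ
2^ᶻ R = + (2 ℕ.^ R)

2^ᶻ-suc : ∀ R → 2^ᶻ (suc R) ≡ + 2 * 2^ᶻ R
2^ᶻ-suc R = ℤP.pos-* 2 (2 ℕ.^ R)

odd-invertible : ∀ R {d} → odd d ≡ true → ∃ λ j → + j * d ≡ + 1 mod 2^ᶻ R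
odd-invertible zero    {d} _ = 0 , (- + 1 , solve (d ∷ []))
odd-invertible (suc R) {d} od with odd-invertible R od
... | j , (q , e) with parity-split q | parity-split d
...   | _             | inj₁ (ev , _) = ⊥-elim (true≢false (trans (sym od) ev))
...   | inj₁ (_ , eq) | inj₂ (_ , _)  = j , (⌊ q /2⌋ᶻ , (begin
  + j * d                           ≡⟨ e ⟩
  + 1 + q * 2^ᶻ R                   ≡⟨ cong (λ x → + 1 + x * 2^ᶻ R) eq ⟩
  + 1 + (+ 2 * ⌊ q /2⌋ᶻ) * 2^ᶻ R    ≡⟨ lemma ⌊ q /2⌋ᶻ (2^ᶻ R) ⟩
  + 1 + ⌊ q /2⌋ᶻ * (+ 2 * 2^ᶻ R)    ≡⟨ cong (λ x → + 1 + ⌊ q /2⌋ᶻ * x) (sym (2^ᶻ-suc R)) ⟩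
  + 1 + ⌊ q /2⌋ᶻ * 2^ᶻ (suc R)      ∎))
  where
  open ≡-Reasoning
  lemma : ∀ x P → + 1 + (+ 2 * x) * P ≡ + 1 + x * (+ 2 * P)
  lemma = solve-∀
...   | inj₂ (_ , eq) | inj₂ (_ , ed) = j ℕ.+ 2 ℕ.^ R , (q' + d' + + 1 , (begin
  + (j ℕ.+ 2 ℕ.^ R) * d                           ≡⟨ cong (_* d) (ℤP.pos-+ j (2 ℕ.^ R)) ⟩
  (+ j + 2^ᶻ R) * d                               ≡⟨ ℤP.*-distribʳ-+ d (+ j) (2^ᶻ R) ⟩
  + j * d + 2^ᶻ R * d                             ≡⟨ cong (_+ 2^ᶻ R * d) e ⟩
  + 1 + q * 2^ᶻ R + 2^ᶻ R * d                     ≡⟨ cong₂ (λ x y → + 1 + x * 2^ᶻ R + 2^ᶻ R * y) eq ed ⟩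
  + 1 + (+ 2 * q' + + 1) * 2^ᶻ R + 2^ᶻ R * (+ 2 * d' + + 1)
                                                  ≡⟨ lemma q' d' (2^ᶻ R) ⟩
  + 1 + (q' + d' + + 1) * (+ 2 * 2^ᶻ R)           ≡⟨ cong (λ x → + 1 + (q' + d' + + 1) * x) (sym (2^ᶻ-suc R)) ⟩
  + 1 + (q' + d' + + 1) * 2^ᶻ (suc R)             ∎))
  where
  open ≡-Reasoning
  q' = ⌊ q /2⌋ᶻ
  d' = ⌊ d /2⌋ᶻ
  lemma : ∀ q d P → + 1 + (+ 2 * q + + 1) * P + P * (+ 2 * d + + 1) ≡ + 1 + (q + d + + 1) * (+ 2 * P)
  lemma = solve-∀

mod-⌊2^⌋ : ∀ R z → z ≡ + ℤDivMod._%ℕ_ z (2 ℕ.^ R) {{ℕP.m^n≢0 2 R}} mod 2^ᶻ R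
mod-⌊2^⌋ R z =
  ℤDivMod._/ℕ_ z (2 ℕ.^ R) {{ℕP.m^n≢0 2 R}} , ℤDivMod.a≡a%ℕn+[a/ℕn]*n z (2 ℕ.^ R) {{ℕP.m^n≢0 2 R}}

odd-invariant⇒constant : ∀ R {f d} → Periodic (2^ᶻ R) f → Invariant f d → odd d ≡ true →
                         ∀ z → f z ≡ f (+ 0)
odd-invariant⇒constant R {f} {d} per inv od z = trans (per (mod-⌊2^⌋ R z)) (on-ℕ _)
  where
  step : ∀ z → f (z + + 1) ≡ f z
  step z with odd-invertible R od
  ... | j , jd≡1 = trans (per (mod-+ˡ z (mod-sym jd≡1))) (invariant-multiples inv j z)
  on-ℕ : ∀ i → f (+ i) ≡ f (+ 0)
  on-ℕ zero    = refl
  on-ℕ (suc i) = trans (cong f (trans (cong +_ (ℕP.+-comm 1 i)) (ℤP.pos-+ i 1))) (trans (step (+ i)) (on-ℕ i))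

parity-invariant⇒constant : ∀ R {f d₀ d₁ u} → Periodic (2^ᶻ (suc R)) f →
  odd d₀ ≡ true → odd d₁ ≡ true → d₀ + d₁ ≡ + 2 * u → odd u ≡ true →
  (∀ a → odd a ≡ false → f a ≡ f (a + d₀)) → (∀ a → odd a ≡ true → f a ≡ f (a + d₁)) →
  ∀ a → f a ≡ f (+ 0)
parity-invariant⇒constant R {f} {d₀} {d₁} {u} per odd-d₀ odd-d₁ d₀+d₁≡2u odd-u step₀ step₁ = constant
  where
  open ≡-Reasoning
  odd-sum : ∀ {a d} → odd a ≡ true → odd d ≡ true → odd (a + d) ≡ false
  odd-sum {a} {d} oa od = trans (odd-+ a d) (cong₂ _xor_ oa od)
  even-odd-sum : ∀ {a d} → odd a ≡ false → odd d ≡ true → odd (a + d) ≡ true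
  even-odd-sum {a} {d} oa od = trans (odd-+ a d) (cong₂ _xor_ oa od)
  on-evens : ∀ b → f (+ 2 * b) ≡ f (+ 0)
  on-evens = odd-invariant⇒constant R
    (λ b≡b' → per (mod-modulus (sym (2^ᶻ-suc R)) (mod-2* b≡b')))
    (λ b → sym (begin
      f (+ 2 * b)                 ≡⟨ step₀ (+ 2 * b) (odd-2* b) ⟩
      f (+ 2 * b + d₀)            ≡⟨ step₁ (+ 2 * b + d₀) (even-odd-sum {+ 2 * b} {d₀} (odd-2* b) odd-d₀) ⟩
      f (+ 2 * b + d₀ + d₁)       ≡⟨ cong f (trans (ℤP.+-assoc (+ 2 * b) d₀ d₁) (trans (cong (λ x → + 2 * b + x) d₀+d₁≡2u)
                                             (sym (ℤP.*-distribˡ-+ (+ 2) b u)))) ⟩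
      f (+ 2 * (b + u))           ∎))
    odd-u
  constant : ∀ a → f a ≡ f (+ 0)
  constant a with parity-split a
  ... | inj₁ (_ , e) = trans (cong f e) (on-evens ⌊ a /2⌋ᶻ)
  ... | inj₂ (oa , _) with parity-split (a + d₁)
  ...   | inj₁ (_ , e)  = trans (step₁ a oa) (trans (cong f e) (on-evens ⌊ a + d₁ /2⌋ᶻ))
  ...   | inj₂ (o' , _) = ⊥-elim (true≢false (trans (sym o') (odd-sum {a} {d₁} oa odd-d₁)))

odd-part : ∀ t x → ¬ 2 ℕ.^ t ∣ x → ∃ λ w → ∃ λ o → w ℕ.< t × oddᵇ o ≡ true × x ≡ 2 ℕ.^ w ℕ.* o
odd-part zero    x ∤x = ⊥-elim (∤x (ℕ∣.1∣ x))
odd-part (suc t) x ∤x with oddᵇ x in ox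
... | true  = 0 , x , s≤s z≤n , ox , sym (ℕP.*-identityˡ x)
... | false =
  let x≡ = even⇒≡2*⌊/2⌋ x ox
      (w , o , w<t , oo , e) = odd-part t ⌊ x /2⌋ (λ d → ∤x (subst (2 ℕ.^ suc t ∣_) (sym x≡) (ℕ∣.*-monoʳ-∣ 2 d)))
  in suc w , o , s≤s w<t , oo , trans x≡ (trans (cong (2 ℕ.*_) e) (sym (ℕP.*-assoc 2 (2 ℕ.^ w) o)))

2^suc∤2^*odd : ∀ w {o} → oddᵇ o ≡ true → ¬ 2 ℕ.^ suc w ∣ 2 ℕ.^ w ℕ.* o
2^suc∤2^*odd w {o} oo d = true≢false (trans (sym oo) (2∣⇒even (ℕ∣.*-cancelˡ-∣ (2 ℕ.^ w) {{ℕP.m^n≢0 2 w}} d')))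
  where
  d' : 2 ℕ.^ w ℕ.* 2 ∣ 2 ℕ.^ w ℕ.* o
  d' = subst (_∣ 2 ℕ.^ w ℕ.* o) (ℕP.*-comm 2 (2 ℕ.^ w)) d

exact-power : ∀ w x → 2 ℕ.^ w ∣ x → ¬ 2 ℕ.^ suc w ∣ x → ∃ λ o → oddᵇ o ≡ true × x ≡ 2 ℕ.^ w ℕ.* o
exact-power w x (divides k x≡) ∤x with oddᵇ k in ok
... | true  = k , ok , trans x≡ (ℕP.*-comm k (2 ℕ.^ w))
... | false = ⊥-elim (∤x (divides ⌊ k /2⌋ (begin
  x                            ≡⟨ x≡ ⟩
  k ℕ.* 2 ℕ.^ w                ≡⟨ cong (ℕ._* 2 ℕ.^ w) (even⇒≡2*⌊/2⌋ k ok) ⟩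
  2 ℕ.* ⌊ k /2⌋ ℕ.* 2 ℕ.^ w    ≡⟨ cong (ℕ._* 2 ℕ.^ w) (ℕP.*-comm 2 ⌊ k /2⌋) ⟩
  ⌊ k /2⌋ ℕ.* 2 ℕ.* 2 ℕ.^ w    ≡⟨ ℕP.*-assoc ⌊ k /2⌋ 2 (2 ℕ.^ w) ⟩
  ⌊ k /2⌋ ℕ.* 2 ℕ.^ suc w      ∎)))
  where open ≡-Reasoning

-- If d₂ = 2^w o with w < t and o odd, some multiple of d₂ + d₂ is congruent to d₁, and f is
-- invariant under d₂ + d₂; so d₁ cannot flip f.
flips-divisibility : ∀ R {f} {d₁ d₂ : ℕ} → Periodic (2^ᶻ R) f → Flips f (+ d₁) → Flips f (+ d₂) →
                     ∀ t → 2 ℕ.^ t ∣ d₁ → ¬ 2 ℕ.^ t ∣ d₂ → ⊥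
flips-divisibility R {f} {d₁} {d₂} per fl₁ fl₂ t (divides x d₁≡) ∤d₂
  with odd-part t d₂ ∤d₂
... | w , o , w<t , oo , d₂≡ with odd-invertible R {+ o} oo
... | j , jo≡1 = fl₁ (+ 0) (begin
  f (+ 0 + + d₁)                      ≡⟨ per d₁≡i*2d₂ ⟩
  f (+ 0 + + i * (+ d₂ + + d₂))       ≡⟨ invariant-multiples (flips⇒invariant-twice fl₂) i (+ 0) ⟩
  f (+ 0)                             ∎)
  where
  open ≡-Reasoning
  u = t ℕ.∸ suc w
  i = 2 ℕ.^ u ℕ.* x ℕ.* j
  A = 2^ᶻ w
  B = 2^ᶻ u
  2^t≡ : 2^ᶻ t ≡ + 2 * A * B
  2^t≡ = begin
    2^ᶻ t                           ≡⟨ cong 2^ᶻ (sym (ℕP.m+[n∸m]≡n w<t)) ⟩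
    + (2 ℕ.^ (suc w ℕ.+ u))         ≡⟨ cong +_ (ℕP.^-distribˡ-+-* 2 (suc w) u) ⟩
    + (2 ℕ.* 2 ℕ.^ w ℕ.* 2 ℕ.^ u)   ≡⟨ ℤP.pos-* (2 ℕ.* 2 ℕ.^ w) (2 ℕ.^ u) ⟩
    2^ᶻ (suc w) * B                 ≡⟨ cong (_* B) (2^ᶻ-suc w) ⟩
    + 2 * A * B                     ∎
  i≡ : + i ≡ B * + x * + j
  i≡ = trans (ℤP.pos-* (2 ℕ.^ u ℕ.* x) j) (cong (_* + j) (ℤP.pos-* (2 ℕ.^ u) x))
  d₂≡A*o : + d₂ ≡ A * + o
  d₂≡A*o = trans (cong +_ d₂≡) (ℤP.pos-* (2 ℕ.^ w) o)
  d₁≡ᶻ : + d₁ ≡ + x * (+ 2 * A * B)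
  d₁≡ᶻ = trans (cong +_ d₁≡) (trans (ℤP.pos-* x (2 ℕ.^ t)) (cong (+ x *_) 2^t≡))
  regroup : ∀ A B X J O → B * X * J * (A * O + A * O) ≡ X * (+ 2 * A * B) * (J * O)
  regroup = solve-∀
  d₁≡i*2d₂ : + 0 + + d₁ ≡ + 0 + + i * (+ d₂ + + d₂) mod 2^ᶻ R
  d₁≡i*2d₂ = mod-+ˡ (+ 0) (mod-sym (mod-cong
    (sym (trans (cong₂ (λ a b → a * (b + b)) i≡ d₂≡A*o) (regroup A B (+ x) (+ j) (+ o))))
    (trans (ℤP.*-identityʳ _) (sym d₁≡ᶻ))
    (mod-*ˡ (+ x * (+ 2 * A * B)) jo≡1)))

flips⇒same-valuation : ∀ R {f} {d₁ d₂ : ℕ} → Periodic (2^ᶻ R) f → Flips f (+ d₁) → Flips f (+ d₂) →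
                       SameVal2 d₁ d₂
flips⇒same-valuation R {d₁ = d₁} {d₂} per fl₁ fl₂ t = mk⇔ (transfer fl₁ fl₂) (transfer fl₂ fl₁)
  where
  transfer : ∀ {a b} → Flips _ (+ a) → Flips _ (+ b) → 2 ℕ.^ t ∣ a → 2 ℕ.^ t ∣ b
  transfer {a} {b} fla flb 2^t∣a with 2 ℕ.^ t ℕ∣.∣? b
  ... | yes 2^t∣b = 2^t∣b
  ... | no  2^t∤b = ⊥-elim (flips-divisibility R per fla flb t 2^t∣a 2^t∤b)

sameVal2-2* : ∀ {a b} → SameVal2 a b → SameVal2 (2 ℕ.* a) (2 ℕ.* b)
sameVal2-2* {a} {b} same zero    = mk⇔ (λ _ → ℕ∣.1∣ _) (λ _ → ℕ∣.1∣ _)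
sameVal2-2* {a} {b} same (suc t) = mk⇔
  (ℕ∣.*-monoʳ-∣ 2 ∘ Equivalence.to (same t) ∘ ℕ∣.*-cancelˡ-∣ 2)
  (ℕ∣.*-monoʳ-∣ 2 ∘ Equivalence.from (same t) ∘ ℕ∣.*-cancelˡ-∣ 2)

bit : ℕ → ℤ → Bool
bit zero    a = odd a
bit (suc v) a = bit v ⌊ a /2⌋ᶻ

bit-periodic : ∀ {v R} → v ℕ.< R → Periodic (2^ᶻ R) (bit v)
bit-periodic {zero}  {suc R} _          a≡b = mod-2*⇒odd≡ {2^ᶻ R} (mod-modulus (2^ᶻ-suc R) a≡b)
bit-periodic {suc v} {suc R} (s≤s v<R) a≡b =
  bit-periodic v<R (mod-2*⇒⌊/2⌋ {2^ᶻ R} (mod-modulus (2^ᶻ-suc R) a≡b))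

bit-flips : ∀ v {o} → odd o ≡ true → Flips (bit v) (2^ᶻ v * o)
bit-flips zero    {o} oo z = ≢-resp (begin
  odd (z + + 1 * o)   ≡⟨ cong (λ x → odd (z + x)) (ℤP.*-identityˡ o) ⟩
  odd (z + o)         ≡⟨ odd-+ z o ⟩
  odd z xor odd o     ≡⟨ cong (odd z xor_) oo ⟩
  odd z xor true      ≡⟨ BoolP.xor-comm (odd z) true ⟩
  not (odd z)         ∎) refl (≢-sym (BoolP.not-¬ refl))
  where open ≡-Reasoning
bit-flips (suc v) {o} oo z = ≢-resp (cong (bit v) (begin
  ⌊ z + 2^ᶻ (suc v) * o /2⌋ᶻ      ≡⟨ cong (λ x → ⌊ z + x /2⌋ᶻ)
                                       (trans (cong (_* o) (2^ᶻ-suc v)) (ℤP.*-assoc (+ 2) (2^ᶻ v) o)) ⟩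
  ⌊ z + + 2 * (2^ᶻ v * o) /2⌋ᶻ    ≡⟨ ⌊+2*/2⌋ᶻ z (2^ᶻ v * o) ⟩
  ⌊ z /2⌋ᶻ + 2^ᶻ v * o            ∎)) refl (bit-flips v oo ⌊ z /2⌋ᶻ)
  where open ≡-Reasoning

-- Colourings of ℤ/2^R separating pairs with sum c₁ or c₂

infix 4 _≡_or_mod_

_≡_or_mod_ : ℤ → ℤ → ℤ → ℤ → Set
s ≡ c₁ or c₂ mod M = s ≡ c₁ mod M ⊎ s ≡ c₂ mod M

record IsSumColouring (M c₁ c₂ : ℤ) (f : ℤ → Bool) : Set where
  field
    periodic  : Periodic M f
    separates : ∀ {a₁ a₂} → a₁ + a₂ ≡ c₁ or c₂ mod M → ¬ a₁ ≡ a₂ mod M → f a₁ ≢ f a₂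

splitByParity : (ℤ → Bool) → (ℤ → Bool) → ℤ → Bool
splitByParity g₀ g₁ a = if odd a then g₁ ⌊ a /2⌋ᶻ else g₀ ⌊ a /2⌋ᶻ

mixed : (ℤ → Bool) → ℤ → ℤ → Bool
mixed g o = splitByParity g (λ b → not (g (o - b)))

-- The graph joining a₁ and a₂ when a₁ + a₂ ≡ c₁ or c₂ is a union of two matchings, hence
-- bipartite; this 2-colouring of it is built by recursion on the lowest binary digits.
mutual
  sumColouring : ℕ → ℤ → ℤ → ℤ → Bool
  sumColouring zero    _  _  _ = false
  sumColouring (suc R) c₁ c₂   = sumColouringStep R (odd c₁) (odd c₂) ⌊ c₁ /2⌋ᶻ ⌊ c₂ /2⌋ᶻ

  sumColouringStep : ℕ → Bool → Bool → ℤ → ℤ → ℤ → Bool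
  sumColouringStep R true  true  _  _  = odd
  sumColouringStep R false false h₁ h₂ =
    splitByParity (sumColouring R h₁ h₂) (sumColouring R (h₁ - + 1) (h₂ - + 1))
  sumColouringStep R false true  e  o  = mixed (sumColouring R e (+ 2 * o + + 1 - e)) o
  sumColouringStep R true  false o  e  = mixed (sumColouring R e (+ 2 * o + + 1 - e)) o

even+even : ∀ x y → + 2 * x + + 2 * y ≡ + 2 * (x + y)
even+even x y = sym (ℤP.*-distribˡ-+ (+ 2) x y)

odd+odd : ∀ x y → + 2 * x + + 1 + (+ 2 * y + + 1) ≡ + 2 * (x + y + + 1)
odd+odd = solve-∀

even+odd : ∀ x y → + 2 * x + (+ 2 * y + + 1) ≡ + 2 * (x + y) + + 1
even+odd = solve-∀

2*+1≢2*-mod : ∀ {M} x y → ¬ + 2 * x + + 1 ≡ + 2 * y mod (+ 2 * M)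
2*+1≢2*-mod x y e = true≢false (trans (sym (odd-2*+1 x)) (trans (mod-2*⇒odd≡ e) (odd-2* y)))

module _ {M : ℤ} where

  splitByParity-periodic : ∀ {g₀ g₁} → Periodic M g₀ → Periodic M g₁ → Periodic (+ 2 * M) (splitByParity g₀ g₁)
  splitByParity-periodic {g₀} {g₁} p₀ p₁ {a} {b} a≡b
    rewrite mod-2*⇒odd≡ a≡b with odd b
  ... | false = p₀ (mod-2*⇒⌊/2⌋ a≡b)
  ... | true  = p₁ (mod-2*⇒⌊/2⌋ a≡b)

  halve-even-sum : ∀ c {a₁ a₂} → a₁ ≡ + 2 * ⌊ a₁ /2⌋ᶻ → a₂ ≡ + 2 * ⌊ a₂ /2⌋ᶻ →
                   a₁ + a₂ ≡ + 2 * c mod (+ 2 * M) → ⌊ a₁ /2⌋ᶻ + ⌊ a₂ /2⌋ᶻ ≡ c mod M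
  halve-even-sum c {a₁} {a₂} e₁ e₂ e =
    mod-2*-cancel (mod-cong (trans (cong₂ _+_ e₁ e₂) (even+even ⌊ a₁ /2⌋ᶻ ⌊ a₂ /2⌋ᶻ)) refl e)

  halve-odd-sum : ∀ c {a₁ a₂} → a₁ ≡ + 2 * ⌊ a₁ /2⌋ᶻ + + 1 → a₂ ≡ + 2 * ⌊ a₂ /2⌋ᶻ + + 1 →
                  a₁ + a₂ ≡ + 2 * c mod (+ 2 * M) → ⌊ a₁ /2⌋ᶻ + ⌊ a₂ /2⌋ᶻ ≡ c - + 1 mod M
  halve-odd-sum c {a₁} {a₂} e₁ e₂ e =
    mod-+⇒- (mod-2*-cancel (mod-cong (trans (cong₂ _+_ e₁ e₂) (odd+odd ⌊ a₁ /2⌋ᶻ ⌊ a₂ /2⌋ᶻ)) refl e))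

  halve-mixed-sum : ∀ c {a₁ a₂} → a₁ ≡ + 2 * ⌊ a₁ /2⌋ᶻ → a₂ ≡ + 2 * ⌊ a₂ /2⌋ᶻ + + 1 →
                    a₁ + a₂ ≡ + 2 * c + + 1 mod (+ 2 * M) → ⌊ a₁ /2⌋ᶻ + ⌊ a₂ /2⌋ᶻ ≡ c mod M
  halve-mixed-sum c {a₁} {a₂} e₁ e₂ e =
    mod-2*+1-cancel (mod-cong (trans (cong₂ _+_ e₁ e₂) (even+odd ⌊ a₁ /2⌋ᶻ ⌊ a₂ /2⌋ᶻ)) refl e)

  mixed-sum-odd : ∀ c {a₁ a₂} → a₁ ≡ + 2 * ⌊ a₁ /2⌋ᶻ → a₂ ≡ + 2 * ⌊ a₂ /2⌋ᶻ + + 1 →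
                  ¬ a₁ + a₂ ≡ + 2 * c mod (+ 2 * M)
  mixed-sum-odd c {a₁} {a₂} e₁ e₂ e =
    2*+1≢2*-mod (⌊ a₁ /2⌋ᶻ + ⌊ a₂ /2⌋ᶻ) c
      (mod-cong (trans (cong₂ _+_ e₁ e₂) (even+odd ⌊ a₁ /2⌋ᶻ ⌊ a₂ /2⌋ᶻ)) refl e)

  even-sum-even : ∀ c {a₁ a₂} → a₁ ≡ + 2 * ⌊ a₁ /2⌋ᶻ → a₂ ≡ + 2 * ⌊ a₂ /2⌋ᶻ →
                  ¬ a₁ + a₂ ≡ + 2 * c + + 1 mod (+ 2 * M)
  even-sum-even c {a₁} {a₂} e₁ e₂ e =
    2*+1≢2*-mod c (⌊ a₁ /2⌋ᶻ + ⌊ a₂ /2⌋ᶻ)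
      (mod-sym (mod-cong (trans (cong₂ _+_ e₁ e₂) (even+even ⌊ a₁ /2⌋ᶻ ⌊ a₂ /2⌋ᶻ)) refl e))

  odd-sum-even : ∀ c {a₁ a₂} → a₁ ≡ + 2 * ⌊ a₁ /2⌋ᶻ + + 1 → a₂ ≡ + 2 * ⌊ a₂ /2⌋ᶻ + + 1 →
                 ¬ a₁ + a₂ ≡ + 2 * c + + 1 mod (+ 2 * M)
  odd-sum-even c {a₁} {a₂} e₁ e₂ e =
    2*+1≢2*-mod c (⌊ a₁ /2⌋ᶻ + ⌊ a₂ /2⌋ᶻ + + 1)
      (mod-sym (mod-cong (trans (cong₂ _+_ e₁ e₂) (odd+odd ⌊ a₁ /2⌋ᶻ ⌊ a₂ /2⌋ᶻ)) refl e))

  odd-isSumColouring : ∀ h₁ h₂ → IsSumColouring (+ 2 * M) (+ 2 * h₁ + + 1) (+ 2 * h₂ + + 1) odd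
  odd-isSumColouring h₁ h₂ = record { periodic = mod-2*⇒odd≡ ; separates = separates }
    where
    separates : ∀ {a₁ a₂} → a₁ + a₂ ≡ + 2 * h₁ + + 1 or + 2 * h₂ + + 1 mod (+ 2 * M) →
                ¬ a₁ ≡ a₂ mod (+ 2 * M) → odd a₁ ≢ odd a₂
    separates {a₁} {a₂} sum _ with parity-split a₁ | parity-split a₂
    ... | inj₁ (o₁ , _)  | inj₂ (o₂ , _)  = λ eq → true≢false (trans (sym o₂) (trans (sym eq) o₁))
    ... | inj₂ (o₁ , _)  | inj₁ (o₂ , _)  = λ eq → true≢false (trans (sym o₁) (trans eq o₂))
    ... | inj₁ (_ , e₁) | inj₁ (_ , e₂) = ⊥-elim ([ even-sum-even h₁ e₁ e₂ , even-sum-even h₂ e₁ e₂ ]′ sum)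
    ... | inj₂ (_ , e₁) | inj₂ (_ , e₂) = ⊥-elim ([ odd-sum-even h₁ e₁ e₂ , odd-sum-even h₂ e₁ e₂ ]′ sum)

  splitByParity-even : ∀ g₀ g₁ a → odd a ≡ false → splitByParity g₀ g₁ a ≡ g₀ ⌊ a /2⌋ᶻ
  splitByParity-even g₀ g₁ a o = cong (λ p → if p then g₁ ⌊ a /2⌋ᶻ else g₀ ⌊ a /2⌋ᶻ) o

  splitByParity-odd : ∀ g₀ g₁ a → odd a ≡ true → splitByParity g₀ g₁ a ≡ g₁ ⌊ a /2⌋ᶻ
  splitByParity-odd g₀ g₁ a o = cong (λ p → if p then g₁ ⌊ a /2⌋ᶻ else g₀ ⌊ a /2⌋ᶻ) o

  split-isSumColouring : ∀ {g₀ g₁} h₁ h₂ → IsSumColouring M h₁ h₂ g₀ →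
                         IsSumColouring M (h₁ - + 1) (h₂ - + 1) g₁ →
                         IsSumColouring (+ 2 * M) (+ 2 * h₁) (+ 2 * h₂) (splitByParity g₀ g₁)
  split-isSumColouring {g₀} {g₁} h₁ h₂ G₀ G₁ = record
    { periodic  = splitByParity-periodic (IsSumColouring.periodic G₀) (IsSumColouring.periodic G₁)
    ; separates = separates }
    where
    f = splitByParity g₀ g₁
    separates : ∀ {a₁ a₂} → a₁ + a₂ ≡ + 2 * h₁ or + 2 * h₂ mod (+ 2 * M) → ¬ a₁ ≡ a₂ mod (+ 2 * M) →
                f a₁ ≢ f a₂
    separates {a₁} {a₂} sum a₁≢a₂ with parity-split a₁ | parity-split a₂
    ... | inj₁ (o₁ , e₁) | inj₁ (o₂ , e₂) =
      ≢-resp (splitByParity-even g₀ g₁ a₁ o₁) (splitByParity-even g₀ g₁ a₂ o₂) (IsSumColouring.separates G₀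
        (Sum.map (halve-even-sum h₁ e₁ e₂) (halve-even-sum h₂ e₁ e₂) sum)
        (λ b₁≡b₂ → a₁≢a₂ (mod-cong (sym e₁) (sym e₂) (mod-2* b₁≡b₂))))
    ... | inj₂ (o₁ , e₁) | inj₂ (o₂ , e₂) =
      ≢-resp (splitByParity-odd g₀ g₁ a₁ o₁) (splitByParity-odd g₀ g₁ a₂ o₂) (IsSumColouring.separates G₁
        (Sum.map (halve-odd-sum h₁ e₁ e₂) (halve-odd-sum h₂ e₁ e₂) sum)
        (λ b₁≡b₂ → a₁≢a₂ (mod-cong (sym e₁) (sym e₂) (mod-2*+1 b₁≡b₂))))
    ... | inj₁ (_ , e₁) | inj₂ (_ , e₂) = ⊥-elim ([ mixed-sum-odd h₁ e₁ e₂ , mixed-sum-odd h₂ e₁ e₂ ]′ sum)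
    ... | inj₂ (_ , e₁) | inj₁ (_ , e₂) =
      ⊥-elim ([ mixed-sum-odd h₁ e₂ e₁ ∘ +-comm-mod a₁ a₂
              , mixed-sum-odd h₂ e₂ e₁ ∘ +-comm-mod a₁ a₂ ]′ sum)

  reflect-sum : ∀ o {b₁ b₂ c} → b₁ + b₂ ≡ c - + 1 mod M → (o - b₁) + (o - b₂) ≡ + 2 * o + + 1 - c mod M
  reflect-sum o {b₁} {b₂} {c} s = mod-cong (lemma₁ o b₁ b₂) (lemma₂ o c) (mod-reflect (+ 2 * o) s)
    where
    lemma₁ : ∀ o b₁ b₂ → + 2 * o - (b₁ + b₂) ≡ (o - b₁) + (o - b₂)
    lemma₁ = solve-∀
    lemma₂ : ∀ o c → + 2 * o - (c - + 1) ≡ + 2 * o + + 1 - c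
    lemma₂ = solve-∀

  mod-reflect-cancel : ∀ o {a b} → o - a ≡ o - b mod M → a ≡ b mod M
  mod-reflect-cancel o {a} {b} e = mod-cong (lemma o a) (lemma o b) (mod-reflect o e)
    where
    lemma : ∀ o a → o - (o - a) ≡ a
    lemma = solve-∀

  mixed-isSumColouring : ∀ {g} e o → IsSumColouring M e (+ 2 * o + + 1 - e) g →
                         IsSumColouring (+ 2 * M) (+ 2 * e) (+ 2 * o + + 1) (mixed g o)
  mixed-isSumColouring {g} e o G = record
    { periodic  = splitByParity-periodic G.periodic (λ a≡b → cong not (G.periodic (mod-reflect o a≡b)))
    ; separates = separates }
    where
    module G = IsSumColouring G
    g' = λ b → not (g (o - b))
    f  = mixed g o
    even-odd : ∀ {a₁ a₂} → a₁ + a₂ ≡ + 2 * e or + 2 * o + + 1 mod (+ 2 * M) →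
               (odd a₁ ≡ false × a₁ ≡ + 2 * ⌊ a₁ /2⌋ᶻ) → (odd a₂ ≡ true × a₂ ≡ + 2 * ⌊ a₂ /2⌋ᶻ + + 1) →
               f a₁ ≢ f a₂
    even-odd {a₁} {a₂} (inj₁ s) (_ , e₁) (_ , e₂) = ⊥-elim (mixed-sum-odd e e₁ e₂ s)
    even-odd {a₁} {a₂} (inj₂ s) (o₁ , e₁) (o₂ , e₂) =
      ≢-resp (trans (splitByParity-even g g' a₁ o₁) (G.periodic (mod-+⇒- (halve-mixed-sum o e₁ e₂ s))))
             (splitByParity-odd g g' a₂ o₂) (BoolP.not-¬ refl)
    separates : ∀ {a₁ a₂} → a₁ + a₂ ≡ + 2 * e or + 2 * o + + 1 mod (+ 2 * M) → ¬ a₁ ≡ a₂ mod (+ 2 * M) →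
                f a₁ ≢ f a₂
    separates {a₁} {a₂} sum a₁≢a₂ with parity-split a₁ | parity-split a₂
    ... | inj₁ (o₁ , e₁) | inj₁ (o₂ , e₂) =
      ≢-resp (splitByParity-even g g' a₁ o₁) (splitByParity-even g g' a₂ o₂) (G.separates
        (inj₁ (halve-even-sum e e₁ e₂ ([ (λ s → s) , (λ s → ⊥-elim (even-sum-even o e₁ e₂ s)) ]′ sum)))
        (λ b₁≡b₂ → a₁≢a₂ (mod-cong (sym e₁) (sym e₂) (mod-2* b₁≡b₂))))
    ... | inj₂ (o₁ , e₁) | inj₂ (o₂ , e₂) =
      ≢-resp (splitByParity-odd g g' a₁ o₁) (splitByParity-odd g g' a₂ o₂) (λ eq → G.separates
        (inj₂ (reflect-sum o (halve-odd-sum e e₁ e₂ ([ (λ s → s) , (λ s → ⊥-elim (odd-sum-even o e₁ e₂ s)) ]′ sum))))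
        (λ r → a₁≢a₂ (mod-cong (sym e₁) (sym e₂) (mod-2*+1 (mod-reflect-cancel o r))))
        (BoolP.not-injective eq))
    ... | inj₁ p₁ | inj₂ p₂ = even-odd sum p₁ p₂
    ... | inj₂ p₁ | inj₁ p₂ = ≢-sym (even-odd (Sum.map (+-comm-mod a₁ a₂) (+-comm-mod a₁ a₂) sum) p₂ p₁)

isSumColouring-swap : ∀ {M c₁ c₂ f} → IsSumColouring M c₁ c₂ f → IsSumColouring M c₂ c₁ f
isSumColouring-swap F = record
  { periodic  = IsSumColouring.periodic F
  ; separates = λ sum → IsSumColouring.separates F (Sum.swap sum) }

sumColouring-isSumColouring : ∀ R c₁ c₂ → IsSumColouring (2^ᶻ R) c₁ c₂ (sumColouring R c₁ c₂)
sumColouring-isSumColouring zero    c₁ c₂ = record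
  { periodic  = λ _ → refl
  ; separates = λ _ a₁≢a₂ → ⊥-elim (a₁≢a₂ (mod-1 _ _)) }
sumColouring-isSumColouring (suc R) c₁ c₂ =
  subst (λ M → IsSumColouring M c₁ c₂ (sumColouring (suc R) c₁ c₂)) (sym (2^ᶻ-suc R))
        (by-parity (parity-split c₁) (parity-split c₂))
  where
  h₁ = ⌊ c₁ /2⌋ᶻ
  h₂ = ⌊ c₂ /2⌋ᶻ
  transport : ∀ {p₁ p₂ x y} → odd c₁ ≡ p₁ → odd c₂ ≡ p₂ → c₁ ≡ x → c₂ ≡ y →
              IsSumColouring (+ 2 * 2^ᶻ R) x y (sumColouringStep R p₁ p₂ h₁ h₂) →
              IsSumColouring (+ 2 * 2^ᶻ R) c₁ c₂ (sumColouring (suc R) c₁ c₂)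
  transport o₁ o₂ refl refl =
    subst (IsSumColouring _ c₁ c₂) (sym (cong₂ (λ p₁ p₂ → sumColouringStep R p₁ p₂ h₁ h₂) o₁ o₂))
  by-parity : ParitySplit c₁ → ParitySplit c₂ →
              IsSumColouring (+ 2 * 2^ᶻ R) c₁ c₂ (sumColouring (suc R) c₁ c₂)
  by-parity (inj₁ (o₁ , e₁)) (inj₁ (o₂ , e₂)) = transport o₁ o₂ e₁ e₂
    (split-isSumColouring h₁ h₂ (sumColouring-isSumColouring R h₁ h₂)
                                (sumColouring-isSumColouring R (h₁ - + 1) (h₂ - + 1)))
  by-parity (inj₂ (o₁ , e₁)) (inj₂ (o₂ , e₂)) = transport o₁ o₂ e₁ e₂ (odd-isSumColouring {2^ᶻ R} h₁ h₂)
  by-parity (inj₁ (o₁ , e₁)) (inj₂ (o₂ , e₂)) = transport o₁ o₂ e₁ e₂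
    (mixed-isSumColouring h₁ h₂ (sumColouring-isSumColouring R h₁ (+ 2 * h₂ + + 1 - h₁)))
  by-parity (inj₂ (o₁ , e₁)) (inj₁ (o₂ , e₂)) = transport o₁ o₂ e₁ e₂
    (isSumColouring-swap (mixed-isSumColouring h₂ h₁ (sumColouring-isSumColouring R h₂ (+ 2 * h₁ + + 1 - h₂))))

distinct-colours⇒partition : ∀ {m} (c : SD m → Bool) u v → c u ≢ c v → IsPartition c
distinct-colours⇒partition c u v cu≢cv with c u in cu | c v in cv
... | true  | false = (u , cu) , (v , cv)
... | false | true  = (v , cv) , (u , cu)
... | true  | true  = ⊥-elim (cu≢cv refl)
... | false | false = ⊥-elim (cu≢cv refl)

≐⇒⊇ : ∀ {m} {U V : Subset m} → U ≐ V → V ⊆ U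
≐⇒⊇ U≐V g Vg = trans (U≐V g) Vg

⊆-antisym : ∀ {m} {U V : Subset m} → U ⊆ V → V ⊆ U → U ≐ V
⊆-antisym {U = U} {V} U⊆V V⊆U g with U g in Ug | V g in Vg
... | true  | true  = refl
... | false | false = refl
... | true  | false = ⊥-elim (true≢false (trans (sym (U⊆V g Ug)) Vg))
... | false | true  = ⊥-elim (true≢false (trans (sym (V⊆U g Vg)) Ug))

⊆-trans : ∀ {m} {U V W : Subset m} → U ⊆ V → V ⊆ W → U ⊆ W
⊆-trans U⊆V V⊆W g = V⊆W g ∘ U⊆V g

avoidable-resp-≐ : ∀ {m} {U V : Subset m} → U ≐ V → Avoidable V → Avoidable U
avoidable-resp-≐ U≐V (c , partition , avoids) =
  c , partition , λ u v u≢v same → trans (U≐V _) (avoids u v u≢v same)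

module _ {m} (Listed : Subset m → Set)
         (listed-avoidable : ∀ {L} → Listed L → Avoidable L)
         (avoidable-⊆-listed : ∀ {V} → Avoidable V → ∃ λ L → Listed L × V ⊆ L)
         (listed-⊆-listed : ∀ {L L'} → Listed L → Listed L' → L ⊆ L' → L' ⊆ L) where

  saturated⇔listed : ∀ U → Saturated U ⇔ (∃ λ L → Listed L × U ≐ L)
  saturated⇔listed U = mk⇔ to from
    where
    to : Saturated U → ∃ λ L → Listed L × U ≐ L
    to (avoidable-U , maximal) with avoidable-⊆-listed avoidable-U
    ... | L , listed , U⊆L = L , listed , ⊆-antisym U⊆L (maximal L (listed-avoidable listed) U⊆L)
    from : (∃ λ L → Listed L × U ≐ L) → Saturated U
    from (L , listed , U≐L) = avoidable-resp-≐ U≐L (listed-avoidable listed) , maximal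
      where
      maximal : ∀ V → Avoidable V → U ⊆ V → V ⊆ U
      maximal V avoidable-V U⊆V with avoidable-⊆-listed avoidable-V
      ... | L' , listed' , V⊆L' =
        ⊆-trans V⊆L' (⊆-trans (listed-⊆-listed listed listed' L⊆L') (≐⇒⊇ U≐L))
        where L⊆L' = ⊆-trans (≐⇒⊇ U≐L) (⊆-trans U⊆V V⊆L')

module SemidihedralGroup (m' : ℕ) where

  m : ℕ
  m = suc (suc (suc (suc m')))

  n : ℕ
  n = ord m

  instance
    n-nonZero : ℕ.NonZero n
    n-nonZero = ord-nz m

  -- N = 2^(m-1), H = 2^(m-2) and K ≡ k, as polynomials in g = 2^(m-4) so that the ring solver
  -- proves congruences such as K * K ≡ 1.
  g N H K : ℤ
  g = + (2 ℕ.^ m')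
  N = + 8 * g
  H = + 4 * g
  K = + 4 * g - + 1

  n≡N : + n ≡ N
  n≡N = trans (2^ᶻ-suc (suc (suc m'))) (trans (cong (+ 2 *_) (2^ᶻ-suc (suc m')))
          (trans (cong (λ z → + 2 * (+ 2 * z)) (2^ᶻ-suc m')) (lemma g)))
    where lemma : ∀ g → + 2 * (+ 2 * (+ 2 * g)) ≡ + 8 * g
          lemma = solve-∀

  half≡H : + half m ≡ H
  half≡H = trans (2^ᶻ-suc (suc m')) (trans (cong (+ 2 *_) (2^ᶻ-suc m')) (lemma g))
    where lemma : ∀ g → + 2 * (+ 2 * g) ≡ + 4 * g
          lemma = solve-∀

  N≡2*H : N ≡ + 2 * H
  N≡2*H = lemma g
    where lemma : ∀ g → + 8 * g ≡ + 2 * (+ 4 * g)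
          lemma = solve-∀

  2*half≡N : + 2 * + half m ≡ N
  2*half≡N = trans (cong (+ 2 *_) half≡H) (sym N≡2*H)

  n≡half+half : n ≡ half m ℕ.+ half m
  n≡half+half = cong (half m ℕ.+_) (ℕP.+-identityʳ (half m))

  half<n : half m ℕ.< n
  half<n = subst (half m ℕ.<_) (sym n≡half+half) (ℕP.m<m+n (half m) (ℕP.m^n>0 2 (suc (suc m'))))

  half≢0 : half m ≢ 0
  half≢0 = ℕ.≢-nonZero⁻¹ (half m) {{ℕP.m^n≢0 2 (suc (suc m'))}}

  8≤n : 8 ℕ.≤ n
  8≤n = subst (8 ℕ.≤_) (sym (ℕP.^-distribˡ-+-* 2 3 m')) (ℕP.*-monoʳ-≤ 8 (ℕP.m^n>0 2 m'))

  4≤half : 4 ℕ.≤ half m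
  4≤half = subst (4 ℕ.≤_) (sym (ℕP.^-distribˡ-+-* 2 2 m')) (ℕP.*-monoʳ-≤ 4 (ℕP.m^n>0 2 m'))

  half∤ : ∀ {X} → X ℕ.< n → X ≢ 0 → X ≢ half m → ¬ half m ∣ X
  half∤ {X} X<n X≢0 X≢half (divides x X≡) = multiple x X≡
    where
    multiple : ∀ x → X ≡ x ℕ.* half m → ⊥
    multiple zero          e = X≢0 e
    multiple (suc zero)    e = X≢half (trans e (ℕP.*-identityˡ (half m)))
    multiple (suc (suc x)) e = ℕP.<⇒≱ X<n (subst (n ℕ.≤_) (sym e)
      (subst (ℕ._≤ half m ℕ.+ (half m ℕ.+ x ℕ.* half m)) (sym n≡half+half)
             (ℕP.+-monoʳ-≤ (half m) (ℕP.m≤m+n (half m) (x ℕ.* half m)))))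

  2^∣-below-n : ∀ t {Y} → 0 ℕ.< Y → Y ℕ.< n → 2 ℕ.^ t ∣ Y → 2 ℕ.^ t ∣ n
  2^∣-below-n t {Y} 0<Y Y<n 2^t∣Y with ℕP.≤-total t (3 ℕ.+ m')
  ... | inj₁ t≤ = divides (2 ℕ.^ (3 ℕ.+ m' ℕ.∸ t))
                    (trans (cong (2 ℕ.^_) (sym (ℕP.m∸n+n≡m t≤))) (ℕP.^-distribˡ-+-* 2 (3 ℕ.+ m' ℕ.∸ t) t))
  ... | inj₂ t≥ = ⊥-elim (ℕP.<⇒≱ Y<n (ℕP.≤-trans (ℕP.^-monoʳ-≤ 2 t≥) (ℕ∣.∣⇒≤ {{ℕ.>-nonZero 0<Y}} 2^t∣Y)))

  sameVal2-complement : ∀ {X} → 0 ℕ.< X → X ℕ.< n → SameVal2 X (n ℕ.∸ X)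
  sameVal2-complement {X} 0<X X<n t = mk⇔
    (λ d → ℕ∣.∣m+n∣m⇒∣n (subst (2 ℕ.^ t ∣_) (sym (ℕP.m+[n∸m]≡n (ℕP.<⇒≤ X<n))) (2^∣-below-n t 0<X X<n d)) d)
    (λ d → ℕ∣.∣m+n∣m⇒∣n (subst (2 ℕ.^ t ∣_) (sym (ℕP.m∸n+n≡m (ℕP.<⇒≤ X<n)))
                          (2^∣-below-n t (ℕP.m<n⇒0<n∸m X<n) (ℕP.∸-monoʳ-< 0<X (ℕP.<⇒≤ X<n)) d)) d)

  infix 4 _≋_

  _≋_ : ℤ → ℤ → Set
  a ≋ b = a ≡ b mod N

  ≋⇒%≡ : ∀ X Y → + X ≋ + Y → X % n ≡ Y % n
  ≋⇒%≡ X Y (+ q , e) = trans (cong (_% n) (ℤP.+-injective (trans e (begin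
    + Y + + q * N                ≡⟨ cong (λ z → + Y + + q * z) (sym n≡N) ⟩
    + Y + + q * + n              ≡⟨ cong (λ z → + Y + z) (sym (ℤP.pos-* q n)) ⟩
    + Y + + (q ℕ.* n)            ≡⟨ sym (ℤP.pos-+ Y (q ℕ.* n)) ⟩
    + (Y ℕ.+ q ℕ.* n)            ∎)))) (ℕDivMod.[m+kn]%n≡m%n Y q n)
    where open ≡-Reasoning
  ≋⇒%≡ X Y (-[1+ q ] , e) = sym (≋⇒%≡ Y X (+ suc q , lemma (+ Y) (+ X) (+ suc q) N e))
    where
    lemma : ∀ Y X q N → X ≡ Y + (- q) * N → Y ≡ X + q * N
    lemma Y X q N refl = solve (Y ∷ q ∷ N ∷ [])

  fin-≋⇒≡ : ∀ {X Y} → X ℕ.< n → Y ℕ.< n → + X ≋ + Y → X ≡ Y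
  fin-≋⇒≡ {X} {Y} X<n Y<n X≋Y =
    trans (sym (ℕDivMod.m<n⇒m%n≡m X<n)) (trans (≋⇒%≡ X Y X≋Y) (ℕDivMod.m<n⇒m%n≡m Y<n))

  small-≋⇒≡ : ∀ {X Y} → X ℕ.< 8 → Y ℕ.< 8 → + X ≋ + Y → X ≡ Y
  small-≋⇒≡ X<8 Y<8 = fin-≋⇒≡ (ℕP.<-≤-trans X<8 8≤n) (ℕP.<-≤-trans Y<8 8≤n)

  %-≋ : ∀ X → + (X % n) ≋ + X
  %-≋ X = mod-sym (+ (X / n) , X≡)
    where
    X≡ : + X ≡ + (X % n) + + (X / n) * N
    X≡ = trans (cong +_ (ℕDivMod.m≡m%n+[m/n]*n X n)) (trans (ℤP.pos-+ (X % n) (X / n ℕ.* n))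
           (cong (λ z → + (X % n) + z) (trans (ℤP.pos-* (X / n) n) (cong (λ z → + (X / n) * z) n≡N))))

  toℕ-red : ∀ X → toℕ (red m X) ≡ X % n
  toℕ-red X = FinP.toℕ-fromℕ< (ℕDivMod.m%n<n X n)

  red-cong : ∀ {X Y} → + X ≋ + Y → red m X ≡ red m Y
  red-cong {X} {Y} X≋Y = FinP.toℕ-injective (trans (toℕ-red X) (trans (≋⇒%≡ X Y X≋Y) (sym (toℕ-red Y))))

  %ℕ-≋ : ∀ z → + (z ℤDivMod.%ℕ n) ≋ z
  %ℕ-≋ z = mod-sym (mod-modulus n≡N (z ℤDivMod./ℕ n , ℤDivMod.a≡a%ℕn+[a/ℕn]*n z n))

  ⟦_⟧ : ℤ → Fin n
  ⟦ z ⟧ = red m (z ℤDivMod.%ℕ n)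

  toℕ⟦⟧-≋ : ∀ z → + toℕ ⟦ z ⟧ ≋ z
  toℕ⟦⟧-≋ z = mod-trans (mod-cong (cong +_ (sym (toℕ-red _))) refl (%-≋ _)) (%ℕ-≋ z)

  ⟦⟧-cong : ∀ {a b} → a ≋ b → ⟦ a ⟧ ≡ ⟦ b ⟧
  ⟦⟧-cong {a} {b} a≋b = red-cong (mod-trans (%ℕ-≋ a) (mod-trans a≋b (mod-sym (%ℕ-≋ b))))

  ⟦⟧-injective : ∀ {a b} → ⟦ a ⟧ ≡ ⟦ b ⟧ → a ≋ b
  ⟦⟧-injective {a} {b} e =
    mod-trans (mod-sym (toℕ⟦⟧-≋ a)) (mod-trans (≡⇒mod (cong (λ i → + toℕ i) e)) (toℕ⟦⟧-≋ b))

  red≡⟦⟧ : ∀ X → red m X ≡ ⟦ + X ⟧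
  red≡⟦⟧ X = red-cong (mod-sym (%ℕ-≋ (+ X)))

  ⟦toℕ⟧ : ∀ (a : Fin n) → ⟦ + toℕ a ⟧ ≡ a
  ⟦toℕ⟧ a = trans (sym (red≡⟦⟧ (toℕ a)))
                  (FinP.toℕ-injective (trans (toℕ-red (toℕ a)) (ℕDivMod.m<n⇒m%n≡m (FinP.toℕ<n a))))

  toℕ⟦⟧≡⇒≋ : ∀ {t X} → toℕ ⟦ t ⟧ ≡ X → t ≋ + X
  toℕ⟦⟧≡⇒≋ {t} e = mod-trans (mod-sym (toℕ⟦⟧-≋ t)) (≡⇒mod (cong +_ e))

  ≋⇒fin≡ : ∀ {a b : Fin n} → + toℕ a ≋ + toℕ b → a ≡ b
  ≋⇒fin≡ {a} {b} a≋b = FinP.toℕ-injective (fin-≋⇒≡ (FinP.toℕ<n a) (FinP.toℕ<n b) a≋b)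

  infix 4 _≋?_

  _≋?_ : ∀ a b → Dec (a ≋ b)
  a ≋? b with ⟦ a ⟧ FinP.≟ ⟦ b ⟧
  ... | yes e = yes (⟦⟧-injective e)
  ... | no ne = no (ne ∘ ⟦⟧-cong)

  ¬0≋H : ¬ + 0 ≋ H
  ¬0≋H e = half≢0 (sym (fin-≋⇒≡ (ℕP.m^n>0 2 (3 ℕ.+ m')) half<n (mod-cong refl (sym half≡H) e)))

  ¬2≋H : ¬ + 2 ≋ H
  ¬2≋H 2≋H = ℕP.<⇒≱ (s≤s (s≤s (s≤s z≤n))) (subst (4 ℕ.≤_) (sym 2≡half) 4≤half)
    where 2≡half = fin-≋⇒≡ (ℕP.<-≤-trans (s≤s (s≤s (s≤s z≤n))) 8≤n) half<n (mod-cong refl (sym half≡H) 2≋H)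

  ≋⇒odd≡ : ∀ {a b} → a ≋ b → odd a ≡ odd b
  ≋⇒odd≡ a≋b = mod-2*⇒odd≡ {H} (mod-modulus N≡2*H a≋b)

  odd-H : odd H ≡ false
  odd-H = ≡2*⇒even (+ 2 * g) (lemma g)
    where lemma : ∀ g → + 4 * g ≡ + 2 * (+ 2 * g)
          lemma = solve-∀

  H≋-H : H ≋ - H
  H≋-H = + 1 , lemma g
    where lemma : ∀ g → + 4 * g ≡ - (+ 4 * g) + + 1 * (+ 8 * g)
          lemma = solve-∀

  ≋⇒mod-H : ∀ {a b} → a ≋ b → a ≡ b mod H
  ≋⇒mod-H a≋b = mod-2*⇒mod (mod-modulus N≡2*H a≋b)

  +H≋⇒mod-H : ∀ {d X} → d + H ≋ X → d ≡ X mod H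
  +H≋⇒mod-H {d} d+H≋X = mod-trans (mod-sym (+ 1 , cong (λ x → d + x) (sym (ℤP.*-identityˡ H)))) (≋⇒mod-H d+H≋X)

  kexp≋K : + kexp m ≋ K
  kexp≋K = + 1 , +-cancelʳ (+ 1) (begin
    + kexp m + + 1                  ≡⟨ sym (ℤP.pos-+ (kexp m) 1) ⟩
    + (kexp m ℕ.+ 1)                ≡⟨ cong +_ kexp+1 ⟩
    + (n ℕ.+ half m)                ≡⟨ trans (ℤP.pos-+ n (half m)) (cong₂ _+_ n≡N half≡H) ⟩
    N + H                           ≡⟨ lemma g ⟩
    K + + 1 * N + + 1               ∎)
    where
    open ≡-Reasoning
    kexp+1 : kexp m ℕ.+ 1 ≡ n ℕ.+ half m
    kexp+1 = begin
      n ℕ.∸ 1 ℕ.+ half m ℕ.+ 1     ≡⟨ ℕP.+-assoc (n ℕ.∸ 1) (half m) 1 ⟩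
      n ℕ.∸ 1 ℕ.+ (half m ℕ.+ 1)   ≡⟨ cong (n ℕ.∸ 1 ℕ.+_) (ℕP.+-comm (half m) 1) ⟩
      n ℕ.∸ 1 ℕ.+ (1 ℕ.+ half m)   ≡⟨ sym (ℕP.+-assoc (n ℕ.∸ 1) 1 (half m)) ⟩
      n ℕ.∸ 1 ℕ.+ 1 ℕ.+ half m     ≡⟨ cong (ℕ._+ half m) (ℕP.m∸n+n≡m (ℕP.m^n>0 2 (suc (suc (suc m'))))) ⟩
      n ℕ.+ half m                 ∎
    lemma : ∀ g → + 8 * g + + 4 * g ≡ + 4 * g - + 1 + + 1 * (+ 8 * g) + + 1
    lemma = solve-∀

  K*K* : ∀ a → K * (K * a) ≋ a
  K*K* a = (+ 2 * g - + 1) * a , lemma g a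
    where lemma : ∀ g a → (+ 4 * g - + 1) * ((+ 4 * g - + 1) * a) ≡ a + ((+ 2 * g - + 1) * a) * (+ 8 * g)
          lemma = solve-∀

  K*-even : ∀ {a} → odd a ≡ false → K * a ≋ - a
  K*-even {a} ev with parity-split a
  ... | inj₂ (od , _) = ⊥-elim (true≢false (trans (sym od) ev))
  ... | inj₁ (_ , e)  = subst (λ w → K * w ≋ - w) (sym e) (⌊ a /2⌋ᶻ , lemma g ⌊ a /2⌋ᶻ)
    where lemma : ∀ g x → (+ 4 * g - + 1) * (+ 2 * x) ≡ - (+ 2 * x) + x * (+ 8 * g)
          lemma = solve-∀

  K*-odd : ∀ {a} → odd a ≡ true → K * a ≋ H - a
  K*-odd {a} od with parity-split a
  ... | inj₁ (ev , _) = ⊥-elim (true≢false (trans (sym od) ev))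
  ... | inj₂ (_ , e)  = subst (λ w → K * w ≋ H - w) (sym e) (⌊ a /2⌋ᶻ , lemma g ⌊ a /2⌋ᶻ)
    where lemma : ∀ g x → (+ 4 * g - + 1) * (+ 2 * x + + 1) ≡ (+ 4 * g - (+ 2 * x + + 1)) + x * (+ 8 * g)
          lemma = solve-∀

  odd-K* : ∀ a → odd (K * a) ≡ odd a
  odd-K* a with odd a in oa
  ... | false = trans (≋⇒odd≡ (K*-even oa)) (trans (odd-neg a) oa)
  ... | true  = trans (≋⇒odd≡ (K*-odd oa)) (trans (odd-- H a) (cong₂ _xor_ odd-H oa))

  K*+≋-solve : ∀ {t} a₁ a₂ → K * a₁ + a₂ ≋ t →
               (odd a₁ ≡ false × a₂ ≋ a₁ + t) ⊎ (odd a₁ ≡ true × a₂ ≋ a₁ + (t - H))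
  K*+≋-solve {t} a₁ a₂ e with odd a₁ in oa
  ... | false = inj₁ (refl , mod-cong refl (lemma t a₁) (mod-trans a₂≋ (mod-reflect t (K*-even oa))))
    where lemma : ∀ t a → t - - a ≡ a + t
          lemma = solve-∀
          a₂≋ = mod-+⇒- (+-comm-mod (K * a₁) a₂ e)
  ... | true  = inj₂ (refl , mod-cong refl (lemma t a₁ H) (mod-trans a₂≋ (mod-reflect t (K*-odd oa))))
    where lemma : ∀ t a h → t - (h - a) ≡ a + (t - h)
          lemma = solve-∀
          a₂≋ = mod-+⇒- (+-comm-mod (K * a₁) a₂ e)

  partner-self : ∀ {t} a → a ≋ t - K * a → (odd a ≡ false × t ≋ + 0) ⊎ (odd a ≡ true × t ≋ H)
  partner-self {t} a a≋ with odd a in oa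
  ... | false = inj₁ (refl , mod-sym (mod-+ˡ-cancel a (mod-cong (sym (ℤP.+-identityʳ a)) (lemma t a)
                                    (mod-trans a≋ (mod-reflect t (K*-even oa))))))
    where lemma : ∀ t a → t - - a ≡ a + t
          lemma = solve-∀
  ... | true  = inj₂ (refl , mod-cong (-‿+-cancelʳ t H) (ℤP.+-identityˡ H) (mod-+ʳ H (mod-sym
                  (mod-+ˡ-cancel a (mod-cong (sym (ℤP.+-identityʳ a)) (lemma t a H)
                                    (mod-trans a≋ (mod-reflect t (K*-odd oa))))))))
    where lemma : ∀ t a h → t - (h - a) ≡ a + (t - h)
          lemma = solve-∀

  not-self-partner : ∀ {t} → ¬ t ≋ + 0 → ¬ t ≋ H → ∀ a → ¬ a ≋ t - K * a
  not-self-partner t≢0 t≢H a a≋ = [ t≢0 ∘ proj₂ , t≢H ∘ proj₂ ]′ (partner-self a a≋)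

  not-self-partner-by-parity : ∀ {t} a → (t ≋ + 0 → odd a ≡ true) → (t ≋ H → odd a ≡ false) → ¬ a ≋ t - K * a
  not-self-partner-by-parity a t≋0⇒odd t≋H⇒even a≋ with partner-self a a≋
  ... | inj₁ (even-a , t≋0) = true≢false (trans (sym (t≋0⇒odd t≋0)) even-a)
  ... | inj₂ (odd-a , t≋H)  = true≢false (trans (sym odd-a) (t≋H⇒even t≋H))

  odd-not-self-partner : ∀ o → odd o ≡ true → ∀ a → ¬ a ≋ o - K * a
  odd-not-self-partner o odd-o a a≋ with partner-self {o} a a≋
  ... | inj₁ (_ , o≋0) = true≢false (trans (sym odd-o) (≋⇒odd≡ o≋0))
  ... | inj₂ (_ , o≋H) = true≢false (trans (sym odd-o) (trans (≋⇒odd≡ o≋H) odd-H))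

  odd--K* : ∀ a b → odd (a - K * b) ≡ odd a xor odd b
  odd--K* a b = trans (odd-- a (K * b)) (cong (odd a xor_) (odd-K* b))

  cross-sum : ∀ o t → (o - K * t) + (t - K * o) ≡ + 2 * ((+ 1 - + 2 * g) * (o + t))
  cross-sum o t = lemma g o t
    where lemma : ∀ g o t → (o - (+ 4 * g - + 1) * t) + (t - (+ 4 * g - + 1) * o) ≡ + 2 * ((+ 1 - + 2 * g) * (o + t))
          lemma = solve-∀

  odd-cross-half : ∀ t o → odd t ≡ false → odd o ≡ true → odd ((+ 1 - + 2 * g) * (o + t)) ≡ true
  odd-cross-half t o even-t odd-o = begin
    odd ((+ 1 - + 2 * g) * (o + t))          ≡⟨ cong odd (lemma g o t) ⟩
    odd (o + t + + 2 * (- g * (o + t)))      ≡⟨ odd-+2* (o + t) (- g * (o + t)) ⟩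
    odd (o + t)                              ≡⟨ trans (odd-+ o t) (cong₂ _xor_ odd-o even-t) ⟩
    true                                     ∎
    where
    open ≡-Reasoning
    lemma : ∀ g o t → (+ 1 - + 2 * g) * (o + t) ≡ o + t + + 2 * (- g * (o + t))
    lemma = solve-∀

  red-+ : ∀ X Y → red m (X ℕ.+ Y) ≡ ⟦ + X + + Y ⟧
  red-+ X Y = trans (red≡⟦⟧ _) (cong ⟦_⟧ (ℤP.pos-+ X Y))

  red-K*+ : ∀ X Y → red m (kexp m ℕ.* X ℕ.+ Y) ≡ ⟦ K * + X + + Y ⟧
  red-K*+ X Y = trans (red≡⟦⟧ _) (⟦⟧-cong (mod-cong (sym (trans (ℤP.pos-+ (kexp m ℕ.* X) Y)
                  (cong (_+ + Y) (ℤP.pos-* (kexp m) X)))) refl (mod-+ʳ (+ Y) (mod-* kexp≋K mod-refl))))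

  ⟦⟧-+ : ∀ a b → ⟦ + toℕ ⟦ a ⟧ + + toℕ ⟦ b ⟧ ⟧ ≡ ⟦ a + b ⟧
  ⟦⟧-+ a b = ⟦⟧-cong (mod-+ (toℕ⟦⟧-≋ a) (toℕ⟦⟧-≋ b))

  ⟦⟧-K*+ : ∀ a b → ⟦ K * + toℕ ⟦ a ⟧ + + toℕ ⟦ b ⟧ ⟧ ≡ ⟦ K * a + b ⟧
  ⟦⟧-K*+ a b = ⟦⟧-cong (mod-+ (mod-*ˡ K (toℕ⟦⟧-≋ a)) (toℕ⟦⟧-≋ b))

  mul-xx : ∀ a b → mul {m} (xp ⟦ a ⟧) (xp ⟦ b ⟧) ≡ xp ⟦ a + b ⟧
  mul-xx a b = cong xp (trans (red-+ (toℕ ⟦ a ⟧) (toℕ ⟦ b ⟧)) (⟦⟧-+ a b))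

  mul-xy : ∀ a b → mul {m} (xp ⟦ a ⟧) (yxp ⟦ b ⟧) ≡ yxp ⟦ K * a + b ⟧
  mul-xy a b = cong yxp (trans (red-K*+ (toℕ ⟦ a ⟧) (toℕ ⟦ b ⟧)) (⟦⟧-K*+ a b))

  mul-yx : ∀ a b → mul {m} (yxp ⟦ a ⟧) (xp ⟦ b ⟧) ≡ yxp ⟦ a + b ⟧
  mul-yx a b = cong yxp (trans (red-+ (toℕ ⟦ a ⟧) (toℕ ⟦ b ⟧)) (⟦⟧-+ a b))

  mul-yy : ∀ a b → mul {m} (yxp ⟦ a ⟧) (yxp ⟦ b ⟧) ≡ xp ⟦ K * a + b ⟧
  mul-yy a b = cong xp (trans (red-K*+ (toℕ ⟦ a ⟧) (toℕ ⟦ b ⟧)) (⟦⟧-K*+ a b))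

  -- Colourings of SD_m as pairs of colourings of exponents

  -- Records rather than plain equations, so that the exponent t can be inferred from a proof.
  infix 4 x^_∈_ yx^_∈_

  record x^_∈_ (t : ℤ) (V : Subset m) : Set where
    constructor x-mem
    field x-member : V (xp ⟦ t ⟧) ≡ true

  record yx^_∈_ (t : ℤ) (V : Subset m) : Set where
    constructor yx-mem
    field yx-member : V (yxp ⟦ t ⟧) ≡ true

  x∈-resp : ∀ {V t t'} → t ≋ t' → x^ t ∈ V → x^ t' ∈ V
  x∈-resp {V} t≋t' (x-mem Vt) = x-mem (trans (cong (V ∘ xp) (⟦⟧-cong (mod-sym t≋t'))) Vt)

  record Avoids (U : Subset m) (P Q : ℤ → Bool) : Set where
    field
      xx : ∀ {t} a₁ a₂ → x^ t ∈ U → a₁ + a₂ ≋ t → ¬ a₁ ≋ a₂ → P a₁ ≢ P a₂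
      xy : ∀ {t} a₁ a₂ → yx^ t ∈ U → K * a₁ + a₂ ≋ t → P a₁ ≢ Q a₂
      yx : ∀ {t} a₁ a₂ → yx^ t ∈ U → a₁ + a₂ ≋ t → Q a₁ ≢ P a₂
      yy : ∀ {t} a₁ a₂ → x^ t ∈ U → K * a₁ + a₂ ≋ t → ¬ a₁ ≋ a₂ → Q a₁ ≢ Q a₂

  colourBy : (ℤ → Bool) → (ℤ → Bool) → SD m → Bool
  colourBy P Q (xp a)  = P (+ toℕ a)
  colourBy P Q (yxp a) = Q (+ toℕ a)

  colourBy-xp : ∀ {P} Q → Periodic N P → ∀ z → colourBy P Q (xp ⟦ z ⟧) ≡ P z
  colourBy-xp Q per z = per (toℕ⟦⟧-≋ z)

  colourBy-avoids : ∀ {U P Q} → Avoids U P Q →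
                    ∀ u v → u ≢ v → colourBy P Q u ≡ colourBy P Q v → U (mul u v) ≡ false
  colourBy-avoids {U} A (xp a) (xp b) u≢v same = BoolP.¬-not λ Uuv →
    Avoids.xx A (+ toℕ a) (+ toℕ b) (x-mem (trans (cong (U ∘ xp) (sym (red-+ (toℕ a) (toℕ b)))) Uuv)) mod-refl
      (λ a≋b → u≢v (cong xp (≋⇒fin≡ a≋b))) same
  colourBy-avoids {U} A (xp a) (yxp b) _ same = BoolP.¬-not λ Uuv →
    Avoids.xy A (+ toℕ a) (+ toℕ b) (yx-mem (trans (cong (U ∘ yxp) (sym (red-K*+ (toℕ a) (toℕ b)))) Uuv)) mod-refl same
  colourBy-avoids {U} A (yxp a) (xp b) _ same = BoolP.¬-not λ Uuv →
    Avoids.yx A (+ toℕ a) (+ toℕ b) (yx-mem (trans (cong (U ∘ yxp) (sym (red-+ (toℕ a) (toℕ b)))) Uuv)) mod-refl same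
  colourBy-avoids {U} A (yxp a) (yxp b) u≢v same = BoolP.¬-not λ Uuv →
    Avoids.yy A (+ toℕ a) (+ toℕ b) (x-mem (trans (cong (U ∘ xp) (sym (red-K*+ (toℕ a) (toℕ b)))) Uuv)) mod-refl
      (λ a≋b → u≢v (cong yxp (≋⇒fin≡ a≋b))) same

  avoidable-by : ∀ {U P Q} → Avoids U P Q → ∀ u v → colourBy P Q u ≢ colourBy P Q v → Avoidable U
  avoidable-by {P = P} {Q} A u v u≢v = colourBy P Q , distinct-colours⇒partition _ u v u≢v , colourBy-avoids A

  -- The listed sets are avoidable

  odd-≋-+ : ∀ {t} a₁ a₂ → a₁ + a₂ ≋ t → odd t ≡ odd a₁ xor odd a₂
  odd-≋-+ a₁ a₂ e = trans (sym (≋⇒odd≡ e)) (odd-+ a₁ a₂)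

  odd-≋-K*+ : ∀ {t} a₁ a₂ → K * a₁ + a₂ ≋ t → odd t ≡ odd a₁ xor odd a₂
  odd-≋-K*+ a₁ a₂ e = trans (sym (≋⇒odd≡ e)) (trans (odd-+ (K * a₁) a₂) (cong (_xor odd a₂) (odd-K* a₁)))

  A∪-xp : ∀ {V : Subset m} → (∀ a → V (xp a) ≡ false) → ∀ t → (SetA m ∪ V) (xp ⟦ t ⟧) ≡ odd t
  A∪-xp {V} V-x t = begin
    isOdd (toℕ ⟦ t ⟧) ∨ V (xp ⟦ t ⟧)  ≡⟨ cong (isOdd (toℕ ⟦ t ⟧) ∨_) (V-x ⟦ t ⟧) ⟩
    isOdd (toℕ ⟦ t ⟧) ∨ false         ≡⟨ BoolP.∨-identityʳ (isOdd (toℕ ⟦ t ⟧)) ⟩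
    isOdd (toℕ ⟦ t ⟧)                 ≡⟨ isOdd≡oddᵇ (toℕ ⟦ t ⟧) ⟩
    odd (+ toℕ ⟦ t ⟧)                 ≡⟨ ≋⇒odd≡ (toℕ⟦⟧-≋ t) ⟩
    odd t                             ∎
    where open ≡-Reasoning

  SetB-yxp : ∀ t → SetB m (yxp ⟦ t ⟧) ≡ not (odd t)
  SetB-yxp t = trans (isEven≡not-oddᵇ (toℕ ⟦ t ⟧)) (cong not (≋⇒odd≡ (toℕ⟦⟧-≋ t)))

  SetC-yxp : ∀ t → SetC m (yxp ⟦ t ⟧) ≡ odd t
  SetC-yxp t = trans (isOdd≡oddᵇ (toℕ ⟦ t ⟧)) (≋⇒odd≡ (toℕ⟦⟧-≋ t))

  odd-colours-x⁰≢x¹ : ∀ {Q} → colourBy odd Q (xp ⟦ + 0 ⟧) ≢ colourBy odd Q (xp ⟦ + 1 ⟧)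
  odd-colours-x⁰≢x¹ {Q} = ≢-resp (colourBy-xp Q ≋⇒odd≡ (+ 0)) (colourBy-xp Q ≋⇒odd≡ (+ 1)) (λ ())

  A∪B-avoidable : Avoidable (SetA m ∪ SetB m)
  A∪B-avoidable = avoidable-by avoids (xp ⟦ + 0 ⟧) (xp ⟦ + 1 ⟧) (odd-colours-x⁰≢x¹ {not ∘ odd})
    where
    odd-x : ∀ {t} → x^ t ∈ SetA m ∪ SetB m → odd t ≡ true
    odd-x {t} (x-mem Ut) = trans (sym (A∪-xp {SetB m} (λ _ → refl) t)) Ut
    even-y : ∀ {t} → yx^ t ∈ SetA m ∪ SetB m → odd t ≡ false
    even-y {t} (yx-mem Ut) = not-true⇒false (trans (sym (SetB-yxp t)) Ut)
    avoids : Avoids (SetA m ∪ SetB m) odd (not ∘ odd)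
    avoids = record
      { xx = λ a₁ a₂ Ut e _ → xor-true⇒≢ (trans (sym (odd-≋-+ a₁ a₂ e)) (odd-x Ut))
      ; xy = λ a₁ a₂ Ut e → BoolP.not-¬ (xor-false⇒≡ (trans (sym (odd-≋-K*+ a₁ a₂ e)) (even-y Ut)))
      ; yx = λ a₁ a₂ Ut e → ≢-sym (BoolP.not-¬ (sym (xor-false⇒≡ (trans (sym (odd-≋-+ a₁ a₂ e)) (even-y Ut)))))
      ; yy = λ a₁ a₂ Ut e _ → xor-true⇒≢ (trans (sym (odd-≋-K*+ a₁ a₂ e)) (odd-x Ut)) ∘ BoolP.not-injective
      }

  A∪C-avoidable : Avoidable (SetA m ∪ SetC m)
  A∪C-avoidable = avoidable-by avoids (xp ⟦ + 0 ⟧) (xp ⟦ + 1 ⟧) (odd-colours-x⁰≢x¹ {odd})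
    where
    odd-x : ∀ {t} → x^ t ∈ SetA m ∪ SetC m → odd t ≡ true
    odd-x {t} (x-mem Ut) = trans (sym (A∪-xp {SetC m} (λ _ → refl) t)) Ut
    odd-y : ∀ {t} → yx^ t ∈ SetA m ∪ SetC m → odd t ≡ true
    odd-y {t} (yx-mem Ut) = trans (sym (SetC-yxp t)) Ut
    avoids : Avoids (SetA m ∪ SetC m) odd odd
    avoids = record
      { xx = λ a₁ a₂ Ut e _ → xor-true⇒≢ (trans (sym (odd-≋-+ a₁ a₂ e)) (odd-x Ut))
      ; xy = λ a₁ a₂ Ut e → xor-true⇒≢ (trans (sym (odd-≋-K*+ a₁ a₂ e)) (odd-y Ut))
      ; yx = λ a₁ a₂ Ut e → xor-true⇒≢ (trans (sym (odd-≋-+ a₁ a₂ e)) (odd-y Ut))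
      ; yy = λ a₁ a₂ Ut e _ → xor-true⇒≢ (trans (sym (odd-≋-K*+ a₁ a₂ e)) (odd-x Ut))
      }

  B∪C-avoidable : Avoidable (SetB m ∪ SetC m)
  B∪C-avoidable = avoidable-by avoids (xp ⟦ + 0 ⟧) (yxp ⟦ + 0 ⟧) true≢false
    where
    avoids : Avoids (SetB m ∪ SetC m) (λ _ → true) (λ _ → false)
    avoids = record
      { xx = λ { _ _ (x-mem ()) }
      ; xy = λ _ _ _ _ → true≢false
      ; yx = λ _ _ _ _ → true≢false ∘ sym
      ; yy = λ { _ _ (x-mem ()) }
      }

  -- yx^a · yx^b = x^t with t ≡ c means b ≡ a + c for even a and b ≡ a + (c - H) for odd a.
  x-pair-avoidable : ∀ {U : Subset m} c₁ c₂ {Q} →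
                     (∀ a → U (yxp a) ≡ false) →
                     (∀ {t} → x^ t ∈ U → t ≡ c₁ or c₂ mod N) →
                     ¬ c₂ ≋ + 0 → Periodic N Q →
                     (∀ {d} → d ≡ c₁ or c₂ mod N ⊎ d + H ≡ c₁ or c₂ mod N → ¬ d ≋ + 0 → Flips Q d) →
                     Avoidable U
  x-pair-avoidable {U} c₁ c₂ {Q} no-y members c₂≢0 Q-periodic Q-flips =
    avoidable-by avoids (xp ⟦ + 0 ⟧) (xp ⟦ c₂ ⟧)
      (≢-resp (colourBy-xp Q P.periodic (+ 0)) (colourBy-xp Q P.periodic c₂)
              (P.separates (inj₂ (≡⇒mod (ℤP.+-identityˡ c₂))) (c₂≢0 ∘ mod-sym)))
    where
    P-isSumColouring = subst (λ M → IsSumColouring M c₁ c₂ (sumColouring (3 ℕ.+ m') c₁ c₂)) n≡N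
                             (sumColouring-isSumColouring (3 ℕ.+ m') c₁ c₂)
    module P = IsSumColouring P-isSumColouring
    no-y' : ∀ {t} → ¬ yx^ t ∈ U
    no-y' {t} (yx-mem Ut) = true≢false (trans (sym Ut) (no-y ⟦ t ⟧))
    translate : ∀ {a₁ a₂ d} → a₂ ≋ a₁ + d → ¬ a₁ ≋ a₂ → (d ≡ c₁ or c₂ mod N ⊎ d + H ≡ c₁ or c₂ mod N) →
                Q a₁ ≢ Q a₂
    translate {a₁} {a₂} {d} a₂≋ a₁≢a₂ d-in =
      ≢-resp refl (Q-periodic a₂≋) (≢-sym (Q-flips d-in (λ d≋0 → a₁≢a₂ (mod-sym (mod-trans a₂≋
        (mod-cong refl (ℤP.+-identityʳ a₁) (mod-+ˡ a₁ d≋0))))) a₁))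
    avoids : Avoids U (sumColouring (3 ℕ.+ m') c₁ c₂) Q
    avoids = record
      { xx = λ a₁ a₂ Ut e → P.separates (Sum.map (mod-trans e) (mod-trans e) (members Ut))
      ; xy = λ _ _ Ut → ⊥-elim (no-y' Ut)
      ; yx = λ _ _ Ut → ⊥-elim (no-y' Ut)
      ; yy = λ {t} a₁ a₂ Ut e a₁≢a₂ → [ (λ (_ , a₂≋) → translate a₂≋ a₁≢a₂ (inj₁ (members Ut)))
                                      , (λ (_ , a₂≋) → translate a₂≋ a₁≢a₂ (inj₂ (subst (_≡ c₁ or c₂ mod N)
                                                          (sym (-‿+-cancelʳ t H)) (members Ut)))) ]′
                                      (K*+≋-solve a₁ a₂ e)
      }

  E0-avoidable : Avoidable (E0 m)
  E0-avoidable = x-pair-avoidable {E0 m} (+ 0) H (λ _ → refl) members (¬0≋H ∘ mod-sym) Q-periodic flips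
    where
    Q = bit (2 ℕ.+ m')
    Q-periodic : Periodic N Q
    Q-periodic = bit-periodic {2 ℕ.+ m'} ℕP.≤-refl ∘ mod-modulus (sym n≡N)
    Q-flips-H : Flips Q H
    Q-flips-H = subst (Flips Q) (trans (ℤP.*-identityʳ _) half≡H) (bit-flips (2 ℕ.+ m') {+ 1} refl)
    members : ∀ {t} → x^ t ∈ E0 m → t ≡ + 0 or H mod N
    members {t} (x-mem Et) with ∨-true⇒ Et
    ... | inj₁ e = inj₁ (toℕ⟦⟧≡⇒≋ (≡ᵇ-true⇒≡ _ _ e))
    ... | inj₂ e = inj₂ (mod-cong refl half≡H (toℕ⟦⟧≡⇒≋ (≡ᵇ-true⇒≡ _ _ e)))
    flips : ∀ {d} → d ≡ + 0 or H mod N ⊎ d + H ≡ + 0 or H mod N → ¬ d ≋ + 0 → Flips Q d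
    flips (inj₁ (inj₁ d≋0))   d≢0 = ⊥-elim (d≢0 d≋0)
    flips (inj₁ (inj₂ d≋H))   _   = flips-resp Q-periodic (mod-sym d≋H) Q-flips-H
    flips (inj₂ (inj₁ d+H≋0)) _   = flips-resp Q-periodic
      (mod-sym (mod-trans (mod-+⇒- d+H≋0) (mod-cong (sym (ℤP.+-identityˡ (- H))) refl (mod-sym H≋-H)))) Q-flips-H
    flips (inj₂ (inj₂ d+H≋H)) d≢0 = ⊥-elim (d≢0 (mod-cong refl (ℤP.+-inverseʳ H) (mod-+⇒- d+H≋H)))

  Pair-avoidable : ∀ e s → toℕ e ≢ 0 → toℕ e ≢ half m → SameVal2 (toℕ e) (toℕ s) → Avoidable (Pair m e s)
  Pair-avoidable e s e≢0 e≢half same-val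
    with odd-part (2 ℕ.+ m') (toℕ e) (half∤ (FinP.toℕ<n e) e≢0 e≢half)
  ... | v , o , v<2+m' , odd-o , e≡ with exact-power v (toℕ s) 2^v∣s 2^suc-v∤s
    where
    2^v∣s = Equivalence.to (same-val v) (divides o (trans e≡ (ℕP.*-comm (2 ℕ.^ v) o)))
    2^suc-v∤s = λ d → 2^suc∤2^*odd v odd-o (subst (2 ℕ.^ suc v ∣_) e≡ (Equivalence.from (same-val (suc v)) d))
  ... | o' , odd-o' , s≡ =
    x-pair-avoidable {Pair m e s} S E (λ _ → refl) members E≢0 Q-periodic flips
    where
    E = + toℕ e
    S = + toℕ s
    Q = bit v
    Q-periodic : Periodic N Q
    Q-periodic = bit-periodic {v} (ℕP.m<n⇒m<1+n v<2+m') ∘ mod-modulus (sym n≡N)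
    Q-periodic-H : Periodic H Q
    Q-periodic-H = bit-periodic {v} v<2+m' ∘ mod-modulus (sym half≡H)
    flips-2^v* : ∀ {X o} → X ≡ 2 ℕ.^ v ℕ.* o → oddᵇ o ≡ true → Flips Q (+ X)
    flips-2^v* {X} {o} X≡ odd-o = subst (Flips Q) (sym (trans (cong +_ X≡) (ℤP.pos-* (2 ℕ.^ v) o))) (bit-flips v odd-o)
    E≢0 : ¬ E ≋ + 0
    E≢0 E≋0 = e≢0 (fin-≋⇒≡ (FinP.toℕ<n e) (ℕP.m^n>0 2 (3 ℕ.+ m')) E≋0)
    members : ∀ {t} → x^ t ∈ Pair m e s → t ≡ S or E mod N
    members {t} (x-mem Pt) with ∨-true⇒ Pt
    ... | inj₁ t≡e = inj₂ (toℕ⟦⟧≡⇒≋ (≡ᵇ-true⇒≡ _ _ t≡e))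
    ... | inj₂ t≡s = inj₁ (toℕ⟦⟧≡⇒≋ (≡ᵇ-true⇒≡ _ _ t≡s))
    flips : ∀ {d} → d ≡ S or E mod N ⊎ d + H ≡ S or E mod N → ¬ d ≋ + 0 → Flips Q d
    flips (inj₁ (inj₁ d≋S))   _ = flips-resp Q-periodic (mod-sym d≋S) (flips-2^v* s≡ odd-o')
    flips (inj₁ (inj₂ d≋E))   _ = flips-resp Q-periodic (mod-sym d≋E) (flips-2^v* e≡ odd-o)
    flips (inj₂ (inj₁ d+H≋S)) _ = flips-resp Q-periodic-H (mod-sym (+H≋⇒mod-H d+H≋S)) (flips-2^v* s≡ odd-o')
    flips (inj₂ (inj₂ d+H≋E)) _ = flips-resp Q-periodic-H (mod-sym (+H≋⇒mod-H d+H≋E)) (flips-2^v* e≡ odd-o)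

  PairConditions : Fin n → Fin n → Set
  PairConditions e s = (2 ∣ toℕ e) × (toℕ e ≢ 0) × (toℕ e ≢ half m)
                     × (toℕ s ≢ 0) × (toℕ s ≢ half m)
                     × SameVal2 (toℕ e) (toℕ s) × (e ≢ s)

  data Listed : Subset m → Set where
    E0-listed   : Listed (E0 m)
    Pair-listed : ∀ e s → PairConditions e s → Listed (Pair m e s)
    A∪B-listed  : Listed (SetA m ∪ SetB m)
    A∪C-listed  : Listed (SetA m ∪ SetC m)
    B∪C-listed  : Listed (SetB m ∪ SetC m)

  listed-avoidable : ∀ {L} → Listed L → Avoidable L
  listed-avoidable E0-listed                                          = E0-avoidable
  listed-avoidable (Pair-listed e s (_ , e≢0 , e≢half , _ , _ , same , _)) = Pair-avoidable e s e≢0 e≢half same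
  listed-avoidable A∪B-listed                                         = A∪B-avoidable
  listed-avoidable A∪C-listed                                         = A∪C-avoidable
  listed-avoidable B∪C-listed                                         = B∪C-avoidable

  -- Constraints imposed by a colouring avoiding V

  module Constraints {V : Subset m} {c : SD m → Bool}
                     (avoids : ∀ u v → u ≢ v → c u ≡ c v → V (mul u v) ≡ false) where

    P Q : ℤ → Bool
    P z = c (xp ⟦ z ⟧)
    Q z = c (yxp ⟦ z ⟧)

    P-periodic : Periodic N P
    P-periodic = cong (c ∘ xp) ∘ ⟦⟧-cong

    Q-periodic : Periodic N Q
    Q-periodic = cong (c ∘ yxp) ∘ ⟦⟧-cong

    product-violates : ∀ {u v w} → V w ≡ true → mul u v ≡ w → u ≢ v → c u ≢ c v
    product-violates Vw uv≡w u≢v same =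
      true≢false (trans (sym Vw) (trans (cong V (sym uv≡w)) (avoids _ _ u≢v same)))

    xp-injective : ∀ {a b : Fin n} → xp {m} a ≡ xp b → a ≡ b
    xp-injective refl = refl

    yxp-injective : ∀ {a b : Fin n} → yxp {m} a ≡ yxp b → a ≡ b
    yxp-injective refl = refl

    edges : Avoids V P Q
    edges = record
      { xx = λ a₁ a₂ (x-mem Vt) e a₁≢a₂ → product-violates Vt (trans (mul-xx a₁ a₂) (cong xp (⟦⟧-cong e)))
                                    (a₁≢a₂ ∘ ⟦⟧-injective ∘ xp-injective)
      ; xy = λ a₁ a₂ (yx-mem Vt) e → product-violates Vt (trans (mul-xy a₁ a₂) (cong yxp (⟦⟧-cong e))) (λ ())
      ; yx = λ a₁ a₂ (yx-mem Vt) e → product-violates Vt (trans (mul-yx a₁ a₂) (cong yxp (⟦⟧-cong e))) (λ ())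
      ; yy = λ a₁ a₂ (x-mem Vt) e a₁≢a₂ → product-violates Vt (trans (mul-yy a₁ a₂) (cong xp (⟦⟧-cong e)))
                                    (a₁≢a₂ ∘ ⟦⟧-injective ∘ yxp-injective)
      }

    open Avoids edges

    P-K-invariant : ∀ {t'} → yx^ t' ∈ V → ∀ z → P z ≡ P (K * z)
    P-K-invariant {t'} Vy z = ≢-≢⇒≡ (xy z (t' - K * z) Vy (≡⇒mod (a+[t-a]≡t (K * z) t')))
                                    (yx (t' - K * z) (K * z) Vy (≡⇒mod (-‿+-cancelʳ t' (K * z))))

    Q-partner : ∀ {t} → x^ t ∈ V → ∀ a → ¬ a ≋ t - K * a → Q a ≢ Q (t - K * a)
    Q-partner {t} Vt a = yy a (t - K * a) Vt (≡⇒mod (a+[t-a]≡t (K * a) t))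

    P-constant-excludes-x : (∀ z → P z ≡ P (+ 0)) → ∀ {s} → ¬ x^ s ∈ V
    P-constant-excludes-x constant {s} Vs with s ≋? + 0
    ... | yes s≋0 = xx (+ 1) (- + 1) Vs (mod-sym s≋0) 1≢-1 (trans (constant (+ 1)) (sym (constant (- + 1))))
      where
      1≢-1 : ¬ + 1 ≋ - + 1
      1≢-1 1≋-1 = ℕP.1+n≢0 (small-≋⇒≡ {2} {0} (s≤s (s≤s (s≤s z≤n))) (s≤s z≤n) (mod-+ʳ (+ 1) 1≋-1))
    ... | no s≢0  = xx (+ 0) s Vs (≡⇒mod (ℤP.+-identityˡ s)) (s≢0 ∘ mod-sym) (sym (constant s))

    y-of-both-parities-excludes-x : ∀ {t₁ t₂ s} → yx^ t₁ ∈ V → yx^ t₂ ∈ V → odd (t₁ - t₂) ≡ true →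
                                    ¬ x^ s ∈ V
    y-of-both-parities-excludes-x {t₁} {t₂} {s} V₁ V₂ odd-d =
      P-constant-excludes-x (odd-invariant⇒constant (3 ℕ.+ m') (P-periodic ∘ mod-modulus n≡N) invariant odd-d) {s}
      where
      lemma₁ : ∀ z t₁ t₂ → z + (t₁ - t₂) ≡ t₁ - (t₂ - z)
      lemma₁ = solve-∀
      lemma₂ : ∀ z t → t - (t - z) ≡ z
      lemma₂ = solve-∀
      invariant : Invariant P (t₁ - t₂)
      invariant z = begin
        P (z + (t₁ - t₂))   ≡⟨ cong P (lemma₁ z t₁ t₂) ⟩
        P (t₁ - (t₂ - z))   ≡⟨ ≢-≢⇒≡ (≢-sym (yx (t₂ - z) (t₁ - (t₂ - z)) V₁ (≡⇒mod (a+[t-a]≡t (t₂ - z) t₁))))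
                                     (yx (t₂ - z) (t₂ - (t₂ - z)) V₂ (≡⇒mod (a+[t-a]≡t (t₂ - z) t₂))) ⟩
        P (t₂ - (t₂ - z))   ≡⟨ cong P (lemma₂ z t₂) ⟩
        P z                 ∎
        where open ≡-Reasoning

    self-paired-x-excludes-y : ∀ {t t'} a → x^ t ∈ V → yx^ t' ∈ V →
                               a + K * a ≋ t → ¬ a ≋ K * a → ⊥
    self-paired-x-excludes-y a Vt Vy a+Ka≋t a≢Ka = xx a (K * a) Vt a+Ka≋t a≢Ka (P-K-invariant Vy a)

    even-x-excludes-y : ∀ {t t'} → x^ t ∈ V → odd t ≡ false → ¬ yx^ t' ∈ V
    even-x-excludes-y {t} {t'} Vt even-t Vy with t ≋? + 0 | t ≋? H
    ... | yes t≋0 | _ = self-paired-x-excludes-y (+ 2) Vt Vy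
      (mod-trans (mod-+ˡ (+ 2) (K*-even {+ 2} refl)) (mod-sym t≋0))
      (λ 2≋K2 → ℕP.1+n≢0 (small-≋⇒≡ {4} {0} (s≤s (s≤s (s≤s (s≤s (s≤s z≤n))))) (s≤s z≤n)
                            (mod-+ʳ (+ 2) (mod-trans 2≋K2 (K*-even {+ 2} refl)))))
    ... | no _ | yes t≋H = self-paired-x-excludes-y (+ 1) Vt Vy
      (mod-trans (mod-+ˡ (+ 1) (K*-odd {+ 1} refl)) (mod-trans (≡⇒mod (a+[t-a]≡t (+ 1) H)) (mod-sym t≋H)))
      (λ 1≋K1 → ¬2≋H (mod-cong refl (-‿+-cancelʳ H (+ 1)) (mod-+ʳ (+ 1) (mod-trans 1≋K1 (K*-odd {+ 1} refl)))))
    -- a is chosen so that t' - (t - K a) ≡ K (t' - a): then Q a, Q (t - K a) and P (t' - a)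
    -- would have to be pairwise distinct.
    ... | no t≢0 | no t≢H = no-three-distinct
      (Q-partner Vt a (not-self-partner t≢0 t≢H a))
      (yx a (t' - a) Vy (≡⇒mod (a+[t-a]≡t a t')))
      (≢-resp refl (trans (P-K-invariant Vy (t' - a)) (sym (P-periodic partner-sum)))
              (yx (t - K * a) (t' - (t - K * a)) Vy (≡⇒mod (a+[t-a]≡t (t - K * a) t'))))
      where
      j = ⌊ t /2⌋ᶻ
      t≡2j : t ≡ + 2 * j
      t≡2j with parity-split t
      ... | inj₁ (_ , e) = e
      ... | inj₂ (o , _) = ⊥-elim (true≢false (trans (sym o) even-t))
      a = t' - + 2 * g * t' - j
      lemma : ∀ g t' j → t' - (+ 2 * j - (+ 4 * g - + 1) * (t' - + 2 * g * t' - j)) ≡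
                         (+ 4 * g - + 1) * (t' - (t' - + 2 * g * t' - j)) + (t' - + 2 * g * t' - j) * (+ 8 * g)
      lemma = solve-∀
      partner-sum : t' - (t - K * a) ≋ K * (t' - a)
      partner-sum = subst (λ w → t' - (w - K * a) ≋ K * (t' - a)) (sym t≡2j) (a , lemma g t' j)

    two-partners : ∀ {t₁ t₂} a → x^ t₁ ∈ V → x^ t₂ ∈ V → ¬ a ≋ t₁ - K * a →
                   ¬ t₁ - K * a ≋ t₂ - K * (t₁ - K * a) → Q a ≡ Q (a + (t₂ - K * t₁))
    two-partners {t₁} {t₂} a V₁ V₂ ne₁ ne₂ = begin
      Q a                               ≡⟨ ≢-≢⇒≡ (Q-partner V₁ a ne₁) (Q-partner V₂ (t₁ - K * a) ne₂) ⟩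
      Q (t₂ - K * (t₁ - K * a))         ≡⟨ Q-periodic (mod-cong (sym (lemma K t₂ t₁ a)) (ℤP.+-comm (t₂ - K * t₁) a)
                                                     (mod-+ˡ (t₂ - K * t₁) (K*K* a))) ⟩
      Q (a + (t₂ - K * t₁))             ∎
      where
      open ≡-Reasoning
      lemma : ∀ k t₂ t₁ a → t₂ - k * (t₁ - k * a) ≡ (t₂ - k * t₁) + k * (k * a)
      lemma = solve-∀

    -- Q a ≡ Q (a + D₁) unless a is its own partner for x^t, and Q a ≡ Q (a + D₂) unless o - K a
    -- is; which exception can occur depends only on the parity of a and on whether t ≡ 0 or
    -- t ≡ H, and D₁, D₂ are odd, so Q is constant.
    Q-constant : ∀ {t o} → x^ t ∈ V → odd t ≡ false → x^ o ∈ V → odd o ≡ true → ∀ a → Q a ≡ Q (+ 0)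
    Q-constant {t} {o} Vt even-t Vo odd-o = by-centrality (t ≋? + 0) (t ≋? H)
      where
      D₁ = o - K * t
      D₂ = t - K * o
      odd-D₁ : odd D₁ ≡ true
      odd-D₁ = trans (odd--K* o t) (cong₂ _xor_ odd-o even-t)
      odd-D₂ : odd D₂ ≡ true
      odd-D₂ = trans (odd--K* t o) (cong₂ _xor_ even-t odd-o)
      odd-o-K* : ∀ a → odd a ≡ false → odd (o - K * a) ≡ true
      odd-o-K* a even-a = trans (odd--K* o a) (cong₂ _xor_ odd-o even-a)
      even-o-K* : ∀ a → odd a ≡ true → odd (o - K * a) ≡ false
      even-o-K* a odd-a = trans (odd--K* o a) (cong₂ _xor_ odd-o odd-a)
      step₁ : ∀ a → ¬ a ≋ t - K * a → Q a ≡ Q (a + D₁)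
      step₁ a ne = two-partners a Vt Vo ne (odd-not-self-partner o odd-o (t - K * a))
      step₂ : ∀ a → ¬ o - K * a ≋ t - K * (o - K * a) → Q a ≡ Q (a + D₂)
      step₂ a ne = two-partners a Vo Vt (odd-not-self-partner o odd-o a) ne
      Q-periodic-n : Periodic (2^ᶻ (3 ℕ.+ m')) Q
      Q-periodic-n = Q-periodic ∘ mod-modulus n≡N
      by-centrality : Dec (t ≋ + 0) → Dec (t ≋ H) → ∀ a → Q a ≡ Q (+ 0)
      by-centrality (yes t≋0) _ = parity-invariant⇒constant (2 ℕ.+ m') Q-periodic-n odd-D₂ odd-D₁
        (trans (ℤP.+-comm D₂ D₁) (cross-sum o t)) (odd-cross-half t o even-t odd-o)
        (λ a even-a → step₂ a (not-self-partner-by-parity {t} (o - K * a) (λ _ → odd-o-K* a even-a) (⊥-elim ∘ t≭H)))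
        (λ a odd-a → step₁ a (not-self-partner-by-parity {t} a (λ _ → odd-a) (⊥-elim ∘ t≭H)))
        where t≭H = λ t≋H → ¬0≋H (mod-trans (mod-sym t≋0) t≋H)
      by-centrality (no _) (yes t≋H) = parity-invariant⇒constant (2 ℕ.+ m') Q-periodic-n odd-D₁ odd-D₂
        (cross-sum o t) (odd-cross-half t o even-t odd-o)
        (λ a even-a → step₁ a (not-self-partner-by-parity {t} a (⊥-elim ∘ t≭0) (λ _ → even-a)))
        (λ a odd-a → step₂ a (not-self-partner-by-parity {t} (o - K * a) (⊥-elim ∘ t≭0) (λ _ → even-o-K* a odd-a)))
        where t≭0 = λ t≋0 → ¬0≋H (mod-trans (mod-sym t≋0) t≋H)
      by-centrality (no t≢0) (no t≢H) = odd-invariant⇒constant (3 ℕ.+ m') Q-periodic-n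
        (λ a → sym (step₁ a (not-self-partner t≢0 t≢H a))) odd-D₁

    even-x-excludes-odd-x : ∀ {t o} → x^ t ∈ V → odd t ≡ false → x^ o ∈ V → odd o ≡ true → ⊥
    even-x-excludes-odd-x {o = o} Vt even-t Vo odd-o =
      Q-partner Vo (+ 0) (odd-not-self-partner o odd-o (+ 0)) (sym (Q-constant Vt even-t Vo odd-o (o - K * + 0)))

    even-flip : ∀ {t} J → x^ t ∈ V → t ≋ + 2 * J → ¬ t ≋ + 0 → Flips (λ b → Q (+ 2 * b)) J
    even-flip {t} J Vt t≋2J t≢0 b =
      ≢-resp (Q-periodic partner≋) refl (≢-sym (Q-partner Vt (+ 2 * b) not-self))
      where
      not-self = not-self-partner-by-parity {t} (+ 2 * b) (⊥-elim ∘ t≢0) (λ _ → odd-2* b)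
      lemma : ∀ x t → x + t ≡ t - - x
      lemma = solve-∀
      partner≋ : + 2 * (b + J) ≋ t - K * (+ 2 * b)
      partner≋ = begin
        + 2 * (b + J)         ≡⟨ ℤP.*-distribˡ-+ (+ 2) b J ⟩
        + 2 * b + + 2 * J     ≈⟨ mod-+ˡ (+ 2 * b) (mod-sym t≋2J) ⟩
        + 2 * b + t           ≡⟨ lemma (+ 2 * b) t ⟩
        t - - (+ 2 * b)       ≈⟨ mod-reflect t (mod-sym (K*-even (odd-2* b))) ⟩
        t - K * (+ 2 * b)     ∎
        where open mod-Reasoning N

    odd-flip : ∀ {t} J → x^ t ∈ V → t ≋ + 2 * J + H → ¬ t ≋ H → Flips (λ b → Q (+ 2 * b + + 1)) J
    odd-flip {t} J Vt t≋2J+H t≢H b =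
      ≢-resp (Q-periodic partner≋) refl (≢-sym (Q-partner Vt (+ 2 * b + + 1) not-self))
      where
      not-self = not-self-partner-by-parity {t} (+ 2 * b + + 1) (λ _ → odd-2*+1 b) (⊥-elim ∘ t≢H)
      lemma₁ : ∀ b J → + 2 * (b + J) + + 1 ≡ + 2 * b + + 1 + + 2 * J
      lemma₁ = solve-∀
      lemma₂ : ∀ a t h → a + (t - h) ≡ t - (h - a)
      lemma₂ = solve-∀
      t-H≋2J : t - H ≋ + 2 * J
      t-H≋2J = mod-cong refl (+-‿-cancelʳ (+ 2 * J) H) (mod-+ʳ (- H) t≋2J+H)
      partner≋ : + 2 * (b + J) + + 1 ≋ t - K * (+ 2 * b + + 1)
      partner≋ = begin
        + 2 * (b + J) + + 1               ≡⟨ lemma₁ b J ⟩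
        + 2 * b + + 1 + + 2 * J           ≈⟨ mod-+ˡ (+ 2 * b + + 1) (mod-sym t-H≋2J) ⟩
        + 2 * b + + 1 + (t - H)           ≡⟨ lemma₂ (+ 2 * b + + 1) t H ⟩
        t - (H - (+ 2 * b + + 1))         ≈⟨ mod-reflect t (mod-sym (K*-odd (odd-2*+1 b))) ⟩
        t - K * (+ 2 * b + + 1)           ∎
        where open mod-Reasoning N

    Q-even-periodic : Periodic (2^ᶻ (2 ℕ.+ m')) (λ b → Q (+ 2 * b))
    Q-even-periodic b≡b' = Q-periodic (mod-modulus 2*half≡N (mod-2* b≡b'))

    Q-odd-periodic : Periodic (2^ᶻ (2 ℕ.+ m')) (λ b → Q (+ 2 * b + + 1))
    Q-odd-periodic b≡b' = Q-periodic (mod-modulus 2*half≡N (mod-2*+1 b≡b'))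

    nonzero-evens-same-valuation : ∀ {e s} → x^ + (2 ℕ.* e) ∈ V → x^ + (2 ℕ.* s) ∈ V →
                                   ¬ + (2 ℕ.* e) ≋ + 0 → ¬ + (2 ℕ.* s) ≋ + 0 → SameVal2 (2 ℕ.* e) (2 ℕ.* s)
    nonzero-evens-same-valuation {e} {s} Ve Vs e≢0 s≢0 = sameVal2-2* (flips⇒same-valuation (2 ℕ.+ m') Q-even-periodic
      (even-flip (+ e) Ve (≡⇒mod (ℤP.pos-* 2 e)) e≢0) (even-flip (+ s) Vs (≡⇒mod (ℤP.pos-* 2 s)) s≢0))

    -- For t ≡ H this is a valuation clash with H itself; for t ≡ 0 the odd exponents of yx are
    -- flipped both by 2^(m-3) and by B/2 + 2^(m-3), whose valuations differ.
    central-excludes-noncentral-even : ∀ {t B} → x^ t ∈ V → t ≋ + 0 ⊎ t ≋ H → x^ + B ∈ V → oddᵇ B ≡ false →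
                                       ¬ + B ≋ + 0 → ¬ + B ≋ H → ¬ half m ∣ B → ⊥
    central-excludes-noncentral-even {t} {B} Vt (inj₂ t≋H) VB even-B B≢0 _ half∤B =
      half∤B (subst (half m ∣_) (sym B≡) (Equivalence.from (same-valuation (2 ℕ.+ m')) ℕ∣.∣-refl))
      where
      B≡ = even⇒≡2*⌊/2⌋ B even-B
      same-valuation : SameVal2 (2 ℕ.* ⌊ B /2⌋) (half m)
      same-valuation = nonzero-evens-same-valuation {⌊ B /2⌋} {2 ℕ.^ suc m'} (subst (λ X → x^ + X ∈ V) B≡ VB)
        (x∈-resp (mod-trans t≋H (≡⇒mod (sym half≡H))) Vt)
        (B≢0 ∘ subst (λ X → + X ≋ + 0) (sym B≡)) (¬0≋H ∘ mod-sym ∘ mod-cong half≡H refl)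
    central-excludes-noncentral-even {t} {B} Vt (inj₁ t≋0) VB even-B _ B≢H half∤B =
      flips-divisibility (2 ℕ.+ m') Q-odd-periodic
        (odd-flip (+ d) Vt (mod-trans t≋0 (mod-sym 2d+H≋0)) (λ t≋H → ¬0≋H (mod-trans (mod-sym t≋0) t≋H)))
        (odd-flip (+ (j ℕ.+ d)) VB B≋ B≢H)
        (suc m') ℕ∣.∣-refl 2^∤j+d
      where
      j = ⌊ B /2⌋
      d = 2 ℕ.^ suc m'
      B≡ = even⇒≡2*⌊/2⌋ B even-B
      lemma₁ : ∀ g → + 2 * (+ 2 * g) + + 4 * g ≡ + 0 + + 1 * (+ 8 * g)
      lemma₁ = solve-∀
      2d+H≋0 : + 2 * + d + H ≋ + 0
      2d+H≋0 = + 1 , trans (cong (λ x → + 2 * x + H) (2^ᶻ-suc m')) (lemma₁ g)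
      lemma₂ : ∀ J D H → + 2 * J + (+ 2 * D + H) ≡ + 2 * (J + D) + H
      lemma₂ = solve-∀
      B≋ : + B ≋ + 2 * + (j ℕ.+ d) + H
      B≋ = mod-cong (sym (trans (cong +_ B≡) (ℤP.pos-* 2 j)))
                    (trans (lemma₂ (+ j) (+ d) H) (cong (λ x → + 2 * x + H) (sym (ℤP.pos-+ j d))))
                    (mod-cong (ℤP.+-identityʳ (+ 2 * + j)) refl (mod-+ˡ (+ 2 * + j) (mod-sym 2d+H≋0)))
      2^∤j : ¬ d ∣ j
      2^∤j d∣j = half∤B (subst (half m ∣_) (sym B≡) (ℕ∣.*-monoʳ-∣ 2 d∣j))
      2^∤j+d : ¬ d ∣ j ℕ.+ d
      2^∤j+d d∣j+d = 2^∤j (ℕ∣.∣m+n∣m⇒∣n (subst (d ∣_) (ℕP.+-comm j d) d∣j+d) ℕ∣.∣-refl)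

    no-three-evens : ∀ {e s w} → x^ + 2 * e ∈ V → x^ + 2 * s ∈ V → x^ + 2 * w ∈ V →
                     ¬ + 2 * e ≋ + 2 * s → ¬ + 2 * e ≋ + 2 * w → ¬ + 2 * s ≋ + 2 * w → ⊥
    no-three-evens {e} {s} {w} VE VS VW E≢S E≢W S≢W = no-three-distinct
      (edge (e + s - w) (e - s + w) VE S≢W (e+s-w+e-s+w e s w) (e-s+w-[e+s-w] e s w))
      (edge (e + s - w) (s + w - e) VS E≢W (e+s-w+[s+w-e] e s w) (e+s-w-[s+w-e] e s w))
      (edge (e - s + w) (s + w - e) VW E≢S (e-s+w+[s+w-e] e s w) (e-s+w-[s+w-e] e s w))
      where
      edge : ∀ {c d₁ d₂} p q → x^ c ∈ V → ¬ d₁ ≋ d₂ → p + q ≡ c → p - q ≡ d₁ - d₂ → P p ≢ P q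
      edge p q Vc d₁≢d₂ p+q≡c p-q≡ = xx p q Vc (≡⇒mod p+q≡c) (λ p≋q → d₁≢d₂ (mod-difference p≋q p-q≡))
      e+s-w+e-s+w : ∀ e s w → (e + s - w) + (e - s + w) ≡ + 2 * e
      e+s-w+e-s+w = solve-∀
      e-s+w-[e+s-w] : ∀ e s w → (e + s - w) - (e - s + w) ≡ + 2 * s - + 2 * w
      e-s+w-[e+s-w] = solve-∀
      e-s+w+[s+w-e] : ∀ e s w → (e - s + w) + (s + w - e) ≡ + 2 * w
      e-s+w+[s+w-e] = solve-∀
      e-s+w-[s+w-e] : ∀ e s w → (e - s + w) - (s + w - e) ≡ + 2 * e - + 2 * s
      e-s+w-[s+w-e] = solve-∀
      e+s-w+[s+w-e] : ∀ e s w → (e + s - w) + (s + w - e) ≡ + 2 * s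
      e+s-w+[s+w-e] = solve-∀
      e+s-w-[s+w-e] : ∀ e s w → (e + s - w) - (s + w - e) ≡ + 2 * e - + 2 * w
      e+s-w-[s+w-e] = solve-∀

  -- Every avoidable set lies in a listed set

  doubled : ∀ (x : Fin n) → oddᵇ (toℕ x) ≡ false → + toℕ x ≡ + 2 * + ⌊ toℕ x /2⌋
  doubled x e = trans (cong +_ (even⇒≡2*⌊/2⌋ (toℕ x) e)) (ℤP.pos-* 2 ⌊ toℕ x /2⌋)

  x∈-fin : ∀ {V} {a : Fin n} → V (xp a) ≡ true → x^ + toℕ a ∈ V
  x∈-fin {V} {a} Va = x-mem (trans (cong (V ∘ xp) (⟦toℕ⟧ a)) Va)

  yx∈-fin : ∀ {V} {a : Fin n} → V (yxp a) ≡ true → yx^ + toℕ a ∈ V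
  yx∈-fin {V} {a} Va = yx-mem (trans (cong (V ∘ yxp) (⟦toℕ⟧ a)) Va)

  ≢0⇒≭0 : ∀ {a : Fin n} → toℕ a ≢ 0 → ¬ + toℕ a ≋ + 0
  ≢0⇒≭0 {a} a≢0 a≋0 = a≢0 (fin-≋⇒≡ (FinP.toℕ<n a) (ℕP.m^n>0 2 (3 ℕ.+ m')) a≋0)

  ≢half⇒≭H : ∀ {a : Fin n} → toℕ a ≢ half m → ¬ + toℕ a ≋ H
  ≢half⇒≭H {a} a≢half a≋H = a≢half (fin-≋⇒≡ (FinP.toℕ<n a) half<n (mod-cong refl (sym half≡H) a≋H))

  central-≋ : ∀ {a : Fin n} → toℕ a ≡ 0 ⊎ toℕ a ≡ half m → + toℕ a ≋ + 0 ⊎ + toℕ a ≋ H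
  central-≋ (inj₁ a≡0)    = inj₁ (≡⇒mod (cong +_ a≡0))
  central-≋ (inj₂ a≡half) = inj₂ (≡⇒mod (trans (cong +_ a≡half) half≡H))

  E0-member : ∀ {b : Fin n} → toℕ b ≡ 0 ⊎ toℕ b ≡ half m → E0 m (xp b) ≡ true
  E0-member = [ ∨-trueˡ ∘ ≡⇒≡ᵇ-true , ∨-trueʳ ∘ ≡⇒≡ᵇ-true ]′

  Pair-member : ∀ {e s b : Fin n} → b ≡ e ⊎ b ≡ s → Pair m e s (xp b) ≡ true
  Pair-member = [ ∨-trueˡ ∘ ≡⇒≡ᵇ-true ∘ cong toℕ , ∨-trueʳ ∘ ≡⇒≡ᵇ-true ∘ cong toℕ ]′

  module Classification {V : Subset m} {c : SD m → Bool}
                        (avoids : ∀ u v → u ≢ v → c u ≡ c v → V (mul u v) ≡ false) where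

    open Constraints {V} {c} avoids

    EvenX : Fin n → Set
    EvenX a = V (xp a) ≡ true × oddᵇ (toℕ a) ≡ false

    evenX? : ∀ a → Dec (EvenX a)
    evenX? a = (V (xp a) BoolP.≟ true) ×-dec (oddᵇ (toℕ a) BoolP.≟ false)

    halved : ∀ {a} → EvenX a → x^ + 2 * + ⌊ toℕ a /2⌋ ∈ V
    halved {a} (Va , even-a) = subst (x^_∈ V) (doubled a even-a) (x∈-fin Va)

    halved-≢ : ∀ {a b} → EvenX a → EvenX b → a ≢ b → ¬ + 2 * + ⌊ toℕ a /2⌋ ≋ + 2 * + ⌊ toℕ b /2⌋
    halved-≢ {a} {b} (_ , even-a) (_ , even-b) a≢b =
      a≢b ∘ ≋⇒fin≡ ∘ mod-cong (sym (doubled a even-a)) (sym (doubled b even-b))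

    only-evens : ∀ {t} → EvenX t → ∀ {U} → (∀ b → EvenX b → U (xp b) ≡ true) → V ⊆ U
    only-evens (Vt , even-t) U-evens (yxp b) Vb = ⊥-elim (even-x-excludes-y (x∈-fin Vt) even-t (yx∈-fin Vb))
    only-evens (Vt , even-t) U-evens (xp b)  Vb with oddᵇ (toℕ b) in odd-b
    ... | true  = ⊥-elim (even-x-excludes-odd-x (x∈-fin Vt) even-t (x∈-fin Vb) odd-b)
    ... | false = U-evens b (Vb , odd-b)

    central-only : ∀ {c} → x^ c ∈ V → c ≋ + 0 ⊎ c ≋ H → ∀ b → EvenX b → toℕ b ≡ 0 ⊎ toℕ b ≡ half m
    central-only Vc c-central b (Vb , even-b) with toℕ b ℕ.≟ 0 | toℕ b ℕ.≟ half m
    ... | yes b≡0 | _         = inj₁ b≡0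
    ... | no _    | yes b≡half = inj₂ b≡half
    ... | no b≢0  | no b≢half = ⊥-elim (central-excludes-noncentral-even Vc c-central (x∈-fin Vb) even-b
                                  (≢0⇒≭0 b≢0) (≢half⇒≭H b≢half) (half∤ (FinP.toℕ<n b) b≢0 b≢half))

    evens-same-valuation : ∀ {a b} → EvenX a → EvenX b → toℕ a ≢ 0 → toℕ b ≢ 0 → SameVal2 (toℕ a) (toℕ b)
    evens-same-valuation {a} {b} (Va , even-a) (Vb , even-b) a≢0 b≢0 =
      subst₂ SameVal2 (sym (even⇒≡2*⌊/2⌋ _ even-a)) (sym (even⇒≡2*⌊/2⌋ _ even-b))
        (nonzero-evens-same-valuation {⌊ toℕ a /2⌋} {⌊ toℕ b /2⌋}
          (subst (λ X → x^ + X ∈ V) (even⇒≡2*⌊/2⌋ _ even-a) (x∈-fin Va))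
          (subst (λ X → x^ + X ∈ V) (even⇒≡2*⌊/2⌋ _ even-b) (x∈-fin Vb))
          (≢0⇒≭0 a≢0 ∘ mod-cong (sym (cong +_ (even⇒≡2*⌊/2⌋ _ even-a))) refl)
          (≢0⇒≭0 b≢0 ∘ mod-cong (sym (cong +_ (even⇒≡2*⌊/2⌋ _ even-b))) refl))

    two-evens : ∀ {t s} → EvenX t → EvenX s → toℕ t ≢ 0 → toℕ t ≢ half m → s ≢ t →
                PairConditions t s × V ⊆ Pair m t s
    two-evens {t} {s} Et@(Vt , even-t) Es@(Vs , _) t≢0 t≢half s≢t =
      (even⇒2∣ _ even-t , t≢0 , t≢half , s≢0 , s≢half , evens-same-valuation Et Es t≢0 s≢0 , ≢-sym s≢t) ,
      only-evens Et (λ b Eb → Pair-member (t-or-s b Eb))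
      where
      t-noncentral : ¬ (toℕ t ≡ 0 ⊎ toℕ t ≡ half m)
      t-noncentral = [ t≢0 , t≢half ]′
      s≢0 : toℕ s ≢ 0
      s≢0 s≡0 = t-noncentral (central-only (x∈-fin Vs) (central-≋ (inj₁ s≡0)) t Et)
      s≢half : toℕ s ≢ half m
      s≢half s≡half = t-noncentral (central-only (x∈-fin Vs) (central-≋ (inj₂ s≡half)) t Et)
      t-or-s : ∀ b → EvenX b → b ≡ t ⊎ b ≡ s
      t-or-s b Eb with b FinP.≟ t | b FinP.≟ s
      ... | yes b≡t | _       = inj₁ b≡t
      ... | no _    | yes b≡s = inj₂ b≡s
      ... | no b≢t  | no b≢s  = ⊥-elim (no-three-evens {+ ⌊ toℕ t /2⌋} {+ ⌊ toℕ s /2⌋} {+ ⌊ toℕ b /2⌋}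
                                  (halved Et) (halved Es) (halved Eb)
                                  (halved-≢ Et Es (≢-sym s≢t)) (halved-≢ Et Eb (≢-sym b≢t))
                                  (halved-≢ Es Eb (≢-sym b≢s)))

    -- A lone even x^t lies in the listed pair {x^t, x^(-t)}.
    single-even : ∀ {t} → EvenX t → toℕ t ≢ 0 → toℕ t ≢ half m → (∀ s → EvenX s → s ≡ t) →
                  ∃ λ s → PairConditions t s × V ⊆ Pair m t s
    single-even {t} Et@(_ , even-t) t≢0 t≢half only-t =
      t' , (even⇒2∣ _ even-t , t≢0 , t≢half , t'≢0 , t'≢half , same , t≢t') ,
      only-evens Et (λ b Eb → Pair-member (inj₁ (only-t b Eb)))
      where
      t<n = FinP.toℕ<n t
      n-t<n : n ℕ.∸ toℕ t ℕ.< n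
      n-t<n = ℕP.∸-monoʳ-< (ℕP.n≢0⇒n>0 t≢0) (ℕP.<⇒≤ t<n)
      t' : Fin n
      t' = Fin.fromℕ< n-t<n
      t'≡ : toℕ t' ≡ n ℕ.∸ toℕ t
      t'≡ = FinP.toℕ-fromℕ< n-t<n
      t'≢0 : toℕ t' ≢ 0
      t'≢0 t'≡0 = ℕP.<⇒≢ (ℕP.m<n⇒0<n∸m t<n) (sym (trans (sym t'≡) t'≡0))
      t'≢half : toℕ t' ≢ half m
      t'≢half t'≡half = t≢half (begin
        toℕ t                        ≡⟨ sym (ℕP.m∸[m∸n]≡n (ℕP.<⇒≤ t<n)) ⟩
        n ℕ.∸ (n ℕ.∸ toℕ t)          ≡⟨ cong (n ℕ.∸_) (trans (sym t'≡) t'≡half) ⟩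
        n ℕ.∸ half m                 ≡⟨ cong (ℕ._∸ half m) n≡half+half ⟩
        half m ℕ.+ half m ℕ.∸ half m ≡⟨ ℕP.m+n∸n≡m (half m) (half m) ⟩
        half m                       ∎)
        where open ≡-Reasoning
      same : SameVal2 (toℕ t) (toℕ t')
      same = subst (SameVal2 (toℕ t)) (sym t'≡) (sameVal2-complement (ℕP.n≢0⇒n>0 t≢0) t<n)
      t≢t' : t ≢ t'
      t≢t' t≡t' = t≢half (ℕP.*-cancelˡ-≡ (toℕ t) (half m) 2 (begin
        2 ℕ.* toℕ t                  ≡⟨ cong (toℕ t ℕ.+_) (ℕP.+-identityʳ (toℕ t)) ⟩
        toℕ t ℕ.+ toℕ t              ≡⟨ cong (toℕ t ℕ.+_) (trans (cong toℕ t≡t') t'≡) ⟩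
        toℕ t ℕ.+ (n ℕ.∸ toℕ t)      ≡⟨ ℕP.m+[n∸m]≡n (ℕP.<⇒≤ t<n) ⟩
        n                            ≡⟨ n≡half+half ⟩
        half m ℕ.+ half m            ≡⟨ cong (half m ℕ.+_) (sym (ℕP.+-identityʳ (half m))) ⟩
        2 ℕ.* half m                 ∎))
        where open ≡-Reasoning

    with-even-x : ∀ {t} → EvenX t → ∃ λ L → Listed L × V ⊆ L
    with-even-x {t} Et with toℕ t ℕ.≟ 0 | toℕ t ℕ.≟ half m
    ... | yes t≡0 | _ =
      E0 m , E0-listed , only-evens Et (λ b → E0-member ∘ central-only (x∈-fin (proj₁ Et)) (central-≋ (inj₁ t≡0)) b)
    ... | no _ | yes t≡half =
      E0 m , E0-listed , only-evens Et (λ b → E0-member ∘ central-only (x∈-fin (proj₁ Et)) (central-≋ (inj₂ t≡half)) b)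
    ... | no t≢0 | no t≢half with FinP.any? (λ s → evenX? s ×-dec ¬? (s FinP.≟ t))
    ...   | yes (s , Es , s≢t) = Pair m t s , Pair-listed t s (proj₁ pair) , proj₂ pair
      where pair = two-evens Et Es t≢0 t≢half s≢t
    ...   | no no-other
      with single-even Et t≢0 t≢half (λ s Es → decidable-stable (s FinP.≟ t) (λ s≢t → no-other (s , Es , s≢t)))
    ...     | s , conditions , V⊆ = Pair m t s , Pair-listed t s conditions , V⊆

    odd-x : ¬ (∃ EvenX) → ∀ a → V (xp a) ≡ true → oddᵇ (toℕ a) ≡ true
    odd-x no-even-x a Va with oddᵇ (toℕ a) in odd-a
    ... | true  = refl
    ... | false = ⊥-elim (no-even-x (a , Va , odd-a))

    without-even-x : ¬ (∃ EvenX) → ∃ λ L → Listed L × V ⊆ L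
    without-even-x no-even-x with FinP.any? (λ a → V (xp a) BoolP.≟ true)
    ... | no no-x = SetB m ∪ SetC m , B∪C-listed , V⊆B∪C
      where
      V⊆B∪C : V ⊆ (SetB m ∪ SetC m)
      V⊆B∪C (xp a)  Va = ⊥-elim (no-x (a , Va))
      V⊆B∪C (yxp b) _  rewrite isEven≡not-oddᵇ (toℕ b) | isOdd≡oddᵇ (toℕ b) with oddᵇ (toℕ b)
      ... | true  = refl
      ... | false = refl
    ... | yes (o , Vo) with FinP.any? (λ b → (V (yxp b) BoolP.≟ true) ×-dec (oddᵇ (toℕ b) BoolP.≟ false))
    ...   | yes (b₀ , Vb₀ , even-b₀) = SetA m ∪ SetB m , A∪B-listed , V⊆A∪B
      where
      V⊆A∪B : V ⊆ (SetA m ∪ SetB m)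
      V⊆A∪B (xp a)  Va = ∨-trueˡ (trans (isOdd≡oddᵇ (toℕ a)) (odd-x no-even-x a Va))
      V⊆A∪B (yxp b) Vb with oddᵇ (toℕ b) in odd-b
      ... | false = trans (isEven≡not-oddᵇ (toℕ b)) (cong not odd-b)
      ... | true  = ⊥-elim (y-of-both-parities-excludes-x (yx∈-fin Vb₀) (yx∈-fin Vb)
                              (trans (odd-- (+ toℕ b₀) (+ toℕ b)) (cong₂ _xor_ even-b₀ odd-b)) (x∈-fin Vo))
    ...   | no no-even-y = SetA m ∪ SetC m , A∪C-listed , V⊆A∪C
      where
      V⊆A∪C : V ⊆ (SetA m ∪ SetC m)
      V⊆A∪C (xp a)  Va = ∨-trueˡ (trans (isOdd≡oddᵇ (toℕ a)) (odd-x no-even-x a Va))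
      V⊆A∪C (yxp b) Vb with oddᵇ (toℕ b) in odd-b
      ... | false = ⊥-elim (no-even-y (b , Vb , odd-b))
      ... | true  = trans (isOdd≡oddᵇ (toℕ b)) odd-b

  avoidable-⊆-listed : ∀ {V} → Avoidable V → ∃ λ L → Listed L × V ⊆ L
  avoidable-⊆-listed {V} (c , _ , avoids) with FinP.any? (Classification.evenX? {V} {c} avoids)
  ... | yes (t , Et) = Classification.with-even-x avoids Et
  ... | no no-even-x = Classification.without-even-x avoids no-even-x

  -- No listed set contains another

  0ₙ 1ₙ : Fin n
  0ₙ = Fin.fromℕ< (ℕP.m^n>0 2 (3 ℕ.+ m'))
  1ₙ = Fin.fromℕ< (ℕP.<-≤-trans (s≤s (s≤s z≤n)) 8≤n)

  toℕ-0ₙ : toℕ 0ₙ ≡ 0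
  toℕ-0ₙ = FinP.toℕ-fromℕ< _

  toℕ-1ₙ : toℕ 1ₙ ≡ 1
  toℕ-1ₙ = FinP.toℕ-fromℕ< _

  ¬⊆-by : ∀ {L L' : Subset m} w → L w ≡ true → L' w ≡ false → ¬ L ⊆ L'
  ¬⊆-by w Lw L'w L⊆L' = true≢false (trans (sym (L⊆L' w Lw)) L'w)

  x⁰∈E0 : E0 m (xp 0ₙ) ≡ true
  x⁰∈E0 = ∨-trueˡ (≡⇒≡ᵇ-true toℕ-0ₙ)

  x⁰∉A∪ : ∀ {V : Subset m} → V (xp 0ₙ) ≡ false → (SetA m ∪ V) (xp 0ₙ) ≡ false
  x⁰∉A∪ {V} V-x⁰ = trans (cong (isOdd (toℕ 0ₙ) ∨_) V-x⁰) (trans (BoolP.∨-identityʳ _) (cong isOdd toℕ-0ₙ))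

  x¹∈A∪ : ∀ {V : Subset m} → (SetA m ∪ V) (xp 1ₙ) ≡ true
  x¹∈A∪ = ∨-trueˡ (cong isOdd toℕ-1ₙ)

  yx⁰∈B : SetB m (yxp 0ₙ) ≡ true
  yx⁰∈B = cong isEven toℕ-0ₙ

  yx⁰∉C : SetC m (yxp 0ₙ) ≡ false
  yx⁰∉C = cong isOdd toℕ-0ₙ

  yx¹∈C : SetC m (yxp 1ₙ) ≡ true
  yx¹∈C = cong isOdd toℕ-1ₙ

  yx¹∉B : SetB m (yxp 1ₙ) ≡ false
  yx¹∉B = cong isEven toℕ-1ₙ

  Pair-members : ∀ {e s b : Fin n} → Pair m e s (xp b) ≡ true → b ≡ e ⊎ b ≡ s
  Pair-members {e} {s} {b} P-b with ∨-true⇒ P-b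
  ... | inj₁ b≡e = inj₁ (FinP.toℕ-injective (≡ᵇ-true⇒≡ _ _ b≡e))
  ... | inj₂ b≡s = inj₂ (FinP.toℕ-injective (≡ᵇ-true⇒≡ _ _ b≡s))

  x^e∉Pair : ∀ {e s b : Fin n} → toℕ b ≢ toℕ e → toℕ b ≢ toℕ s → Pair m e s (xp b) ≡ false
  x^e∉Pair b≢e b≢s = cong₂ _∨_ (≢⇒≡ᵇ-false b≢e) (≢⇒≡ᵇ-false b≢s)

  x^e∉A∪ : ∀ {V : Subset m} {e : Fin n} → 2 ∣ toℕ e → V (xp e) ≡ false → (SetA m ∪ V) (xp e) ≡ false
  x^e∉A∪ {e = e} 2∣e V-e = trans (cong (isOdd (toℕ e) ∨_) V-e)
    (trans (BoolP.∨-identityʳ _) (trans (isOdd≡oddᵇ (toℕ e)) (2∣⇒even 2∣e)))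

  Pair-⊆-Pair : ∀ {e s e' s'} → e ≢ s → Pair m e s ⊆ Pair m e' s' → Pair m e' s' ⊆ Pair m e s
  Pair-⊆-Pair {e} {s} {e'} {s'} e≢s P⊆P' (xp b) P'-b
    with Pair-members {e'} {s'} {b} P'-b | Pair-members {e'} {s'} {e} (P⊆P' (xp e) (Pair-member {e} {s} (inj₁ refl)))
       | Pair-members {e'} {s'} {s} (P⊆P' (xp s) (Pair-member {e} {s} (inj₂ refl)))
  ... | inj₁ refl | inj₁ refl | _         = Pair-member {e} {s} (inj₁ refl)
  ... | inj₁ refl | inj₂ refl | inj₁ refl = Pair-member {e} {s} (inj₂ refl)
  ... | inj₁ refl | inj₂ refl | inj₂ refl = ⊥-elim (e≢s refl)
  ... | inj₂ refl | inj₂ refl | _         = Pair-member {e} {s} (inj₁ refl)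
  ... | inj₂ refl | inj₁ refl | inj₂ refl = Pair-member {e} {s} (inj₂ refl)
  ... | inj₂ refl | inj₁ refl | inj₁ refl = ⊥-elim (e≢s refl)
  Pair-⊆-Pair _ _ (yxp _) ()

  listed-⊆-listed : ∀ {L L'} → Listed L → Listed L' → L ⊆ L' → L' ⊆ L
  listed-⊆-listed E0-listed E0-listed = λ _ _ → id
  listed-⊆-listed E0-listed (Pair-listed e s (_ , e≢0 , _ , s≢0 , _)) =
    ⊥-elim ∘ ¬⊆-by (xp 0ₙ) x⁰∈E0
      (x^e∉Pair (λ 0≡e → e≢0 (trans (sym 0≡e) toℕ-0ₙ)) (λ 0≡s → s≢0 (trans (sym 0≡s) toℕ-0ₙ)))
  listed-⊆-listed E0-listed A∪B-listed = ⊥-elim ∘ ¬⊆-by (xp 0ₙ) x⁰∈E0 (x⁰∉A∪ {SetB m} refl)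
  listed-⊆-listed E0-listed A∪C-listed = ⊥-elim ∘ ¬⊆-by (xp 0ₙ) x⁰∈E0 (x⁰∉A∪ {SetC m} refl)
  listed-⊆-listed E0-listed B∪C-listed = ⊥-elim ∘ ¬⊆-by (xp 0ₙ) x⁰∈E0 refl
  listed-⊆-listed (Pair-listed e s (_ , e≢0 , e≢half , _)) E0-listed =
    ⊥-elim ∘ ¬⊆-by (xp e) (Pair-member {e} {s} (inj₁ refl)) (cong₂ _∨_ (≢⇒≡ᵇ-false e≢0) (≢⇒≡ᵇ-false e≢half))
  listed-⊆-listed (Pair-listed e s (2∣e , _)) A∪B-listed = ⊥-elim ∘ ¬⊆-by (xp e) (Pair-member {e} {s} (inj₁ refl)) (x^e∉A∪ {SetB m} 2∣e refl)
  listed-⊆-listed (Pair-listed e s (2∣e , _)) A∪C-listed = ⊥-elim ∘ ¬⊆-by (xp e) (Pair-member {e} {s} (inj₁ refl)) (x^e∉A∪ {SetC m} 2∣e refl)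
  listed-⊆-listed (Pair-listed e s _) B∪C-listed = ⊥-elim ∘ ¬⊆-by (xp e) (Pair-member {e} {s} (inj₁ refl)) refl
  listed-⊆-listed (Pair-listed e s (_ , _ , _ , _ , _ , _ , e≢s)) (Pair-listed _ _ _) = Pair-⊆-Pair e≢s
  listed-⊆-listed A∪B-listed E0-listed         = ⊥-elim ∘ ¬⊆-by (yxp 0ₙ) yx⁰∈B refl
  listed-⊆-listed A∪B-listed (Pair-listed _ _ _) = ⊥-elim ∘ ¬⊆-by (yxp 0ₙ) yx⁰∈B refl
  listed-⊆-listed A∪B-listed A∪B-listed        = λ _ _ → id
  listed-⊆-listed A∪B-listed A∪C-listed        = ⊥-elim ∘ ¬⊆-by (yxp 0ₙ) yx⁰∈B yx⁰∉C
  listed-⊆-listed A∪B-listed B∪C-listed        = ⊥-elim ∘ ¬⊆-by (xp 1ₙ) (x¹∈A∪ {SetB m}) refl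
  listed-⊆-listed A∪C-listed E0-listed         = ⊥-elim ∘ ¬⊆-by (yxp 1ₙ) yx¹∈C refl
  listed-⊆-listed A∪C-listed (Pair-listed _ _ _) = ⊥-elim ∘ ¬⊆-by (yxp 1ₙ) yx¹∈C refl
  listed-⊆-listed A∪C-listed A∪B-listed        = ⊥-elim ∘ ¬⊆-by (yxp 1ₙ) yx¹∈C yx¹∉B
  listed-⊆-listed A∪C-listed A∪C-listed        = λ _ _ → id
  listed-⊆-listed A∪C-listed B∪C-listed        = ⊥-elim ∘ ¬⊆-by (xp 1ₙ) (x¹∈A∪ {SetC m}) refl
  listed-⊆-listed B∪C-listed E0-listed         = ⊥-elim ∘ ¬⊆-by (yxp 0ₙ) (∨-trueˡ yx⁰∈B) refl
  listed-⊆-listed B∪C-listed (Pair-listed _ _ _) = ⊥-elim ∘ ¬⊆-by (yxp 0ₙ) (∨-trueˡ yx⁰∈B) refl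
  listed-⊆-listed B∪C-listed A∪B-listed        = ⊥-elim ∘ ¬⊆-by (yxp 1ₙ) (∨-trueʳ yx¹∈C) yx¹∉B
  listed-⊆-listed B∪C-listed A∪C-listed        = ⊥-elim ∘ ¬⊆-by (yxp 0ₙ) (∨-trueˡ yx⁰∈B) yx⁰∉C
  listed-⊆-listed B∪C-listed B∪C-listed        = λ _ _ → id

  Classified : Subset m → Set
  Classified U =
    (U ≐ E0 m)
    ⊎ (Σ (Fin (ord m)) λ e → Σ (Fin (ord m)) λ s →
         (2 ∣ toℕ e) × (toℕ e ≢ 0) × (toℕ e ≢ half m)
         × (toℕ s ≢ 0) × (toℕ s ≢ half m)
         × SameVal2 (toℕ e) (toℕ s) × (e ≢ s)
         × (U ≐ Pair m e s))
    ⊎ (U ≐ (SetA m ∪ SetB m))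
    ⊎ (U ≐ (SetA m ∪ SetC m))
    ⊎ (U ≐ (SetB m ∪ SetC m))

  ≐-listed⇔classified : ∀ U → (∃ λ L → Listed L × U ≐ L) ⇔ Classified U
  ≐-listed⇔classified U = mk⇔ to from
    where
    to : (∃ λ L → Listed L × U ≐ L) → Classified U
    to (_ , E0-listed , U≐) = inj₁ U≐
    to (_ , Pair-listed e s (c₁ , c₂ , c₃ , c₄ , c₅ , c₆ , c₇) , U≐) =
      inj₂ (inj₁ (e , s , c₁ , c₂ , c₃ , c₄ , c₅ , c₆ , c₇ , U≐))
    to (_ , A∪B-listed , U≐) = inj₂ (inj₂ (inj₁ U≐))
    to (_ , A∪C-listed , U≐) = inj₂ (inj₂ (inj₂ (inj₁ U≐)))
    to (_ , B∪C-listed , U≐) = inj₂ (inj₂ (inj₂ (inj₂ U≐)))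
    from : Classified U → ∃ λ L → Listed L × U ≐ L
    from (inj₁ U≐) = _ , E0-listed , U≐
    from (inj₂ (inj₁ (e , s , c₁ , c₂ , c₃ , c₄ , c₅ , c₆ , c₇ , U≐))) =
      _ , Pair-listed e s (c₁ , c₂ , c₃ , c₄ , c₅ , c₆ , c₇) , U≐
    from (inj₂ (inj₂ (inj₁ U≐)))         = _ , A∪B-listed , U≐
    from (inj₂ (inj₂ (inj₂ (inj₁ U≐)))) = _ , A∪C-listed , U≐
    from (inj₂ (inj₂ (inj₂ (inj₂ U≐)))) = _ , B∪C-listed , U≐

  saturated⇔classified : ∀ U → Saturated U ⇔ Classified U
  saturated⇔classified U = mk⇔
    (Equivalence.to (≐-listed⇔classified U) ∘ Equivalence.to (saturated U))
    (Equivalence.from (saturated U) ∘ Equivalence.from (≐-listed⇔classified U))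
    where saturated = saturated⇔listed Listed listed-avoidable avoidable-⊆-listed listed-⊆-listed

theorem4p8 : ∀ (m : ℕ) → 3 < m → (U : Subset m) →
    Saturated U ⇔
      ( (U ≐ E0 m)
      ⊎ (Σ (Fin (ord m)) λ e → Σ (Fin (ord m)) λ s →
           (2 ∣ toℕ e) × (toℕ e ≢ 0) × (toℕ e ≢ half m)
           × (toℕ s ≢ 0) × (toℕ s ≢ half m)
           × SameVal2 (toℕ e) (toℕ s) × (e ≢ s)
           × (U ≐ Pair m e s))
      ⊎ (U ≐ (SetA m ∪ SetB m))
      ⊎ (U ≐ (SetA m ∪ SetC m))
      ⊎ (U ≐ (SetB m ∪ SetC m)) )
theorem4p8 (suc (suc (suc (suc m')))) _ = SemidihedralGroup.saturated⇔classified m'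
theorem4p8 (suc (suc (suc zero)))     (s≤s (s≤s (s≤s ())))
theorem4p8 (suc (suc zero))           (s≤s (s≤s ()))
theorem4p8 (suc zero)                 (s≤s ())
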